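{- Call a finite union-closed family $\mathcal{F}$ of sets an $(f,k,n)$-construction if there are precisely $f$ elements each of which belongs to more than half of the sets of $\mathcal{F}$, and $k$ and $n$ are the sizes of a smallest set and of the largest set of $\mathcal{F}$, respectively. Then: \begin{enumerate} \item There exist a $(2,3,8)$-construction, a $(3,4,9)$-construction, a $(4,5,9)$-construction and a $(5,6,10)$-construction, each of which is twin-free. \item There is a twin-free $(2,k,n)$-construction for all integers $k,n$ satisfying $$\sum_{i=k-1}^{\lfloor n/2\rfloor-1}\binom{\lfloor n/2\rfloor-1}{i} > \binom{n-3}{k-3}+\binom{\lfloor n/2\rfloor-2}{k-2};$$ moreover, for every $k$ this inequality holds for all sufficiently large $n$. \item There is a $(2,k,n)$-construction for all nonnegative integers $k,n$ with $n\geq\max\{3,5k-4\}$; furthermore, if $k$ is even, $n\geq\max\{3,5k-8\}$ suffices. \item There is a $(k-1,k,n)$-construction for all integers $k,n$ satisfying $n-4\geq k\geq 3$ and $n\geq 9$. \end{enumerate}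
   Context: A family of sets is a collection of pairwise distinct sets; it is union-closed if the union of any two of its sets belongs to it. Two elements $a,b$ are twins in a family $\mathcal{F}$ if every set $A\in\mathcal{F}$ satisfies $|A\cap\{a,b\}|\neq 1$; $\mathcal{F}$ is twin-free if it has no pair of twins. -}

module Defs where

open import Data.Nat using (ℕ; zero; suc; _+_; _*_; _∸_; _<_; _≤_; _<?_)
open import Data.Nat.DivMod using (_/_)
open import Data.Nat.Combinatorics using (_C_)
open import Data.Fin using (Fin)
open import Data.Fin.Subset using (Subset; _∈_; _∪_; _∩_; ⁅_⁆; ∣_∣)
open import Data.Fin.Subset.Properties using (_∈?_)
open import Data.List using (List; length; filter; map; upTo; allFin)
open import Data.Nat.ListAction using (sum)
import Data.List.Membership.Propositional as LM
open import Data.List.Relation.Unary.Unique.Propositional using (Unique)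
open import Data.Product using (Σ; _×_; ∃-syntax)
open import Relation.Binary.PropositionalEquality using (_≡_; _≢_)
open import Relation.Nullary using (¬_)

Family : ℕ → Set
Family m = List (Subset m)

Distinct : ∀ {m} → Family m → Set
Distinct F = Unique F

UnionClosed : ∀ {m} → Family m → Set
UnionClosed F = ∀ A B → A LM.∈ F → B LM.∈ F → (A ∪ B) LM.∈ F

ElementOf : ∀ {m} → Fin m → Family m → Set
ElementOf x F = ∃[ A ] (A LM.∈ F × x ∈ A)

Twins : ∀ {m} → Family m → Fin m → Fin m → Set
Twins F a b = a ≢ b × (∀ A → A LM.∈ F → ∣ A ∩ (⁅ a ⁆ ∪ ⁅ b ⁆) ∣ ≢ 1)

TwinFree : ∀ {m} → Family m → Set
TwinFree F = ∀ a b → ElementOf a F → ElementOf b F → ¬ Twins F a b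

degree : ∀ {m} → Family m → Fin m → ℕ
degree F x = length (filter (x ∈?_) F)

frequentCount : ∀ {m} → Family m → ℕ
frequentCount {m} F = length (filter (λ x → length F <? 2 * degree F x) (allFin m))

MinSize : ∀ {m} → Family m → ℕ → Set
MinSize F k = ∃[ A ] (A LM.∈ F × ∣ A ∣ ≡ k) × (∀ B → B LM.∈ F → k ≤ ∣ B ∣)

MaxSize : ∀ {m} → Family m → ℕ → Set
MaxSize F n = ∃[ A ] (A LM.∈ F × ∣ A ∣ ≡ n) × (∀ B → B LM.∈ F → ∣ B ∣ ≤ n)

IsConstruction : ∀ {m} → Family m → ℕ → ℕ → ℕ → Set
IsConstruction F f k n =
  Distinct F × UnionClosed F × frequentCount F ≡ f × MinSize F k × MaxSize F n

Construction : ℕ → ℕ → ℕ → Set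
Construction f k n = ∃[ m ] Σ (Family m) λ F → IsConstruction F f k n

TwinFreeConstruction : ℕ → ℕ → ℕ → Set
TwinFreeConstruction f k n = ∃[ m ] Σ (Family m) λ F → IsConstruction F f k n × TwinFree F

-- Σ_{i=a}^{b} g i  (empty, i.e. 0, when b < a)
sumFromTo : ℕ → ℕ → (ℕ → ℕ) → ℕ
sumFromTo a b g = sum (map (λ j → g (a + j)) (upTo (suc b ∸ a)))

-- the inequality of part 2 (intended for k ≥ 3):
-- Σ_{i=k-1}^{⌊n/2⌋-1} C(⌊n/2⌋-1, i) > C(n-3, k-3) + C(⌊n/2⌋-2, k-2)
Ineq : ℕ → ℕ → Set
Ineq k n = ((n ∸ 3) C (k ∸ 3)) + (((n / 2) ∸ 2) C (k ∸ 2))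
           < sumFromTo (k ∸ 1) ((n / 2) ∸ 1) (λ i → ((n / 2) ∸ 1) C i)

-- Part 1, and the cases k ≤ 3 of part 3, are explicit families checked by evaluation.
--
-- The main construction lives on {a, b} ∪ Y ∪ Z with |Y| = |Z| = d. It consists of the sets
-- {a} ∪ y and {b} ∪ z with y ⊆ Y, z ⊆ Z of size at least k - 1, and {a, b} ∪ w with w ⊆ Y ∪ Z
-- of size at least k - 2. It is union-closed and twin-free, a and b lie in more than half of
-- its sets, and an element of Y ∪ Z lies in at most half of them exactly when C(2d - 1, k - 3)
-- is at most twice the number of subsets of a (d - 1)-set of size at least k - 1; by Pascal's
-- rule this is the inequality of part 2 for n = 2d + 2. Odd n are reached by adding an element
-- that lies in exactly half of the sets. The right-hand side grows like d^(k-1) and the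
-- left-hand side like d^(k-3), so the inequality eventually holds.
--
-- For part 3 every element of the instance k = 4, d = 5 is replaced by a block of copies: this
-- multiplies set sizes by the block weights and keeps a and b as the only frequent elements.
-- For part 4, adding a new element to every set turns an (f, k, n)- into an
-- (f + 1, k + 1, n + 1)-construction; start from the (4, 5, 9)-construction and add
-- half-elements to reach larger n.

module Submission where

open import Defs
open import Data.Nat using (ℕ; zero; suc; _+_; _*_; _∸_; _^_; _⊔_; _≤_; _<_; _≤ᵇ_; _≡ᵇ_; _≤?_; _<?_; z≤n; s≤s; _≤′_; ≤′-refl; ≤′-step)
open import Data.Nat.Properties
open import Data.Nat.Combinatorics using (_C_; nCk+nC[k+1]≡[n+1]C[k+1])
open import Data.Nat.DivMod using (_/_; _%_; m/n≡1+[m∸n]/n; m/n*n≤m; m≡m%n+[m/n]*n; m%n<n; m*n/n≡m; /-monoˡ-≤; [m+kn]%n≡m%n; m*n%n≡0)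
open import Data.Nat.Divisibility using (_∣_; divides)
open import Data.Nat.ListAction using (sum)
open import Data.Nat.Solver using (module +-*-Solver)
open import Data.Bool using (Bool; true; false; not; _∧_; _∨_; T)
open import Data.Bool.ListAction using (all; any)
open import Data.Bool.Properties using (∧-comm; ∧-identityʳ; ∧-zeroʳ; T-∧; T-∨)
open import Data.Fin using (Fin; zero; suc; _↑ˡ_; _↑ʳ_; splitAt) renaming (_≟_ to _≟ᶠ_)
open import Data.Fin.Properties using (splitAt-↑ˡ; splitAt-↑ʳ; splitAt⁻¹-↑ˡ; splitAt⁻¹-↑ʳ)
open import Data.Fin.Subset using (Subset; _∪_; _∩_; ⁅_⁆; ∣_∣; ∁; ⊤; ⊥) renaming (_∈_ to _∈ₛ_; _∉_ to _∉ₛ_)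
open import Data.Fin.Subset.Properties
  using (⊆-antisym; x∈p∩q⁺; x∈p∩q⁻; x∈p∪q⁺; x∈p∪q⁻; x∈⁅x⁆; x∈⁅y⁆⇒x≡y; x∈p⇒x∉∁p; x∉p⇒x∈∁p; ∪-comm; ∪-idem;
         ∣⁅x⁆∣≡1; ∣⊥∣≡0; ∣⊤∣≡n; ∣p∣≤n; ∣p∣≤∣x∷p∣; ∣p∣≤∣p∪q∣; ∣∁p∣≡n∸∣p∣)
  renaming (_∈?_ to _∈ₛ?_)
open import Data.Vec using (Vec; []; _∷_; lookup; replicate; here; there) renaming (_++_ to _++ᵛ_)
open import Data.Vec.Properties
  using (∷-injectiveˡ; ∷-injectiveʳ; ++-injectiveˡ; ++-injectiveʳ; lookup-++ˡ; lookup-++ʳ; lookup-splitAt;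
         lookup-replicate; zipWith-++; zipWith-replicate)
open import Data.List using (List; []; _∷_; length; map; _++_; filter; allFin; tabulate; upTo; applyUpTo)
open import Data.List.Properties using (length-map; length-++; map-applyUpTo)
open import Data.List.Membership.Propositional using (_∈_; find)
open import Data.List.Membership.Propositional.Properties using (∈-map⁺; ∈-map⁻; ∈-++⁺ˡ; ∈-++⁺ʳ; ∈-++⁻; ∈-filter⁺; ∈-filter⁻; ∈-allFin)
import Data.List.Relation.Unary.All as All
open import Data.List.Relation.Unary.All.Properties using (all⁺)
import Data.List.Relation.Unary.AllPairs as AllPairs
import Data.List.Relation.Unary.Any as Any
open import Data.List.Relation.Unary.Any.Properties using (any⁺; any⁻)
import Data.List.Relation.Unary.Unique.Propositional.Properties as Unique
open import Data.Product using (_×_; _,_; proj₂; ∃-syntax)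
open import Data.Sum using (inj₁; inj₂; [_,_]; [_,_]′)
open import Function using (_∘_; const; _⇔_; mk⇔; Equivalence; _⟨_⟩_)
open import Relation.Binary.PropositionalEquality using (_≡_; _≢_; refl; sym; trans; cong; cong₂; subst; subst₂; module ≡-Reasoning)
open import Relation.Nullary using (¬_; Dec; does; yes; no; contradiction)
open import Relation.Nullary.Decidable using (dec-true; dec-false; isYes; toWitness; from-yes)

bit : Bool → ℕ
bit true = 1
bit false = 0

count : {A : Set} → (A → Bool) → List A → ℕ
count p [] = 0
count p (x ∷ xs) = bit (p x) + count p xs

module _ {A : Set} where

  length-filter≡count : {P : A → Set} (P? : ∀ x → Dec (P x)) (xs : List A) →
                        length (filter P? xs) ≡ count (does ∘ P?) xs
  length-filter≡count P? [] = refl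
  length-filter≡count P? (x ∷ xs) with does (P? x)
  ... | true = cong suc (length-filter≡count P? xs)
  ... | false = length-filter≡count P? xs

  count-filter : {P : A → Set} (P? : ∀ x → Dec (P x)) (q : A → Bool) (xs : List A) →
                 count q (filter P? xs) ≡ count (λ x → does (P? x) ∧ q x) xs
  count-filter P? q [] = refl
  count-filter P? q (x ∷ xs) with does (P? x)
  ... | true = cong (bit (q x) +_) (count-filter P? q xs)
  ... | false = count-filter P? q xs

  count-++ : (p : A → Bool) (xs ys : List A) → count p (xs ++ ys) ≡ count p xs + count p ys
  count-++ p [] ys = refl
  count-++ p (x ∷ xs) ys = trans (cong (bit (p x) +_) (count-++ p xs ys)) (sym (+-assoc (bit (p x)) _ _))

  count-map : {B : Set} (p : B → Bool) (f : A → B) (xs : List A) → count p (map f xs) ≡ count (p ∘ f) xs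
  count-map p f [] = refl
  count-map p f (x ∷ xs) = cong (bit (p (f x)) +_) (count-map p f xs)

  count-cong : {p q : A → Bool} (xs : List A) → (∀ x → p x ≡ q x) → count p xs ≡ count q xs
  count-cong [] e = refl
  count-cong (x ∷ xs) e = cong₂ _+_ (cong bit (e x)) (count-cong xs e)

  count-true : (xs : List A) → count (λ _ → true) xs ≡ length xs
  count-true [] = refl
  count-true (x ∷ xs) = cong suc (count-true xs)

  count-false : (xs : List A) → count (λ _ → false) xs ≡ 0
  count-false [] = refl
  count-false (x ∷ xs) = count-false xs

  count-∧-true : (p : A → Bool) (xs : List A) → count (λ x → p x ∧ true) xs ≡ count p xs
  count-∧-true p xs = count-cong xs (λ x → ∧-identityʳ (p x))

  count-∧-false : (p : A → Bool) (xs : List A) → count (λ x → p x ∧ false) xs ≡ 0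
  count-∧-false p xs = trans (count-cong xs (λ x → ∧-zeroʳ (p x))) (count-false xs)

  count-pos : (p : A → Bool) {xs : List A} {x : A} → x ∈ xs → T (p x) → 0 < count p xs
  count-pos p {y ∷ xs} (Any.here refl) px with p y
  ... | true = s≤s z≤n
  count-pos p {y ∷ xs} (Any.there x∈) px = ≤-trans (count-pos p x∈ px) (m≤n+m _ (bit (p y)))

countFin : ∀ n → (Fin n → Bool) → ℕ
countFin zero p = 0
countFin (suc n) p = bit (p zero) + countFin n (p ∘ suc)

count-allFin : ∀ {n} (p : Fin n → Bool) → count p (allFin n) ≡ countFin n p
count-allFin = go (λ i → i)
  where
  go : ∀ {m n} (f : Fin m → Fin n) (p : Fin n → Bool) → count p (tabulate f) ≡ countFin m (p ∘ f)
  go {zero} f p = refl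
  go {suc m} f p = cong (bit (p (f zero)) +_) (go (f ∘ suc) p)

countFin-cong : ∀ n {p q : Fin n → Bool} → (∀ x → p x ≡ q x) → countFin n p ≡ countFin n q
countFin-cong zero e = refl
countFin-cong (suc n) e = cong₂ _+_ (cong bit (e zero)) (countFin-cong n (e ∘ suc))

deg : ∀ {m} → Family m → Fin m → ℕ
deg F x = count (λ A → lookup A x) F

degree≡deg : ∀ {m} (F : Family m) x → degree F x ≡ deg F x
degree≡deg F x = trans (length-filter≡count (x ∈ₛ?_) F) (count-cong F (does-∈? x))
  where
  does-∈? : ∀ {m} (x : Fin m) (A : Subset m) → does (x ∈ₛ? A) ≡ lookup A x
  does-∈? zero (true ∷ A) = refl
  does-∈? zero (false ∷ A) = refl
  does-∈? (suc x) (b ∷ A) = does-∈? x A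

majority : ℕ → ℕ → Bool
majority total d = does (total <? 2 * d)

majority-true : ∀ {total} d → total < 2 * d → majority total d ≡ true
majority-true {total} d = dec-true (total <? 2 * d)

majority-false : ∀ {total} d → 2 * d ≤ total → majority total d ≡ false
majority-false {total} d h = dec-false (total <? 2 * d) (λ lt → <⇒≱ lt h)

majority-double : ∀ total d → majority (total + total) (d + d) ≡ majority total d
majority-double total d with total <? 2 * d
... | yes lt = trans (majority-true (d + d) (subst (total + total <_) (sym (*-distribˡ-+ 2 d d)) (+-mono-< lt lt)))
                     (sym (majority-true d lt))
... | no ≮ = trans (majority-false (d + d) (subst (_≤ total + total) (sym (*-distribˡ-+ 2 d d)) (+-mono-≤ ≥ ≥)))
                   (sym (majority-false d ≥))
  where ≥ = ≮⇒≥ ≮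

majority-A+W : ∀ A W → 0 < W → majority (A + (A + W)) (A + W) ≡ true
majority-A+W A W 0<W = majority-true (A + W) (subst (A + (A + W) <_) (solve 2 (λ A W → (A :+ (A :+ W)) :+ W := con 2 :* (A :+ W)) refl A W) (m<m+n _ 0<W))
  where open +-*-Solver

frequentCount≡countFin : ∀ {m} (F : Family m) → frequentCount F ≡ countFin m (λ x → majority (length F) (deg F x))
frequentCount≡countFin {m} F =
  trans (length-filter≡count (λ x → length F <? 2 * degree F x) (allFin m))
        (trans (count-allFin {m} _) (countFin-cong m (λ x → cong (majority (length F)) (degree≡deg F x))))

∩-pair-separated : ∀ {m} {A : Subset m} {a b} → a ∈ₛ A → b ∉ₛ A → A ∩ (⁅ a ⁆ ∪ ⁅ b ⁆) ≡ ⁅ a ⁆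
∩-pair-separated {A = A} {a} {b} a∈A b∉A = ⊆-antisym ⊆⁅a⁆ ⁅a⁆⊆
  where
  ⊆⁅a⁆ : ∀ {x} → x ∈ₛ A ∩ (⁅ a ⁆ ∪ ⁅ b ⁆) → x ∈ₛ ⁅ a ⁆
  ⊆⁅a⁆ x∈ with x∈p∩q⁻ A _ x∈
  ... | x∈A , x∈pair with x∈p∪q⁻ ⁅ a ⁆ ⁅ b ⁆ x∈pair
  ...   | inj₁ x∈⁅a⁆ = x∈⁅a⁆
  ...   | inj₂ x∈⁅b⁆ = contradiction (subst (_∈ₛ A) (x∈⁅y⁆⇒x≡y b x∈⁅b⁆) x∈A) b∉A
  ⁅a⁆⊆ : ∀ {x} → x ∈ₛ ⁅ a ⁆ → x ∈ₛ A ∩ (⁅ a ⁆ ∪ ⁅ b ⁆)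
  ⁅a⁆⊆ x∈⁅a⁆ = x∈p∩q⁺ (subst (_∈ₛ A) (sym (x∈⁅y⁆⇒x≡y a x∈⁅a⁆)) a∈A , x∈p∪q⁺ (inj₁ x∈⁅a⁆))

Twins-sym : ∀ {m} {F : Family m} {a b} → Twins F a b → Twins F b a
Twins-sym {a = a} {b} (a≢b , tw) = a≢b ∘ sym , λ A A∈ → tw A A∈ ∘ subst (λ S → ∣ A ∩ S ∣ ≡ 1) (∪-comm ⁅ b ⁆ ⁅ a ⁆)

separated⇒¬Twins : ∀ {m} {F : Family m} {A a b} → A ∈ F → a ∈ₛ A → b ∉ₛ A → ¬ Twins F a b
separated⇒¬Twins {A = A} {a} A∈ a∈A b∉A (_ , tw) = tw A A∈ (trans (cong ∣_∣ (∩-pair-separated a∈A b∉A)) (∣⁅x⁆∣≡1 a))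

-- Boolean tests rather than Dec-valued ones: normalising the Dec proofs for the
-- concrete families below exhausts memory.
_==ˢ_ : ∀ {m} → Subset m → Subset m → Bool
[] ==ˢ [] = true
(true ∷ u) ==ˢ (true ∷ v) = u ==ˢ v
(false ∷ u) ==ˢ (false ∷ v) = u ==ˢ v
(_ ∷ _) ==ˢ (_ ∷ _) = false

==ˢ⇒≡ : ∀ {m} (u v : Subset m) → T (u ==ˢ v) → u ≡ v
==ˢ⇒≡ [] [] _ = refl
==ˢ⇒≡ (true ∷ u) (true ∷ v) h = cong (true ∷_) (==ˢ⇒≡ u v h)
==ˢ⇒≡ (false ∷ u) (false ∷ v) h = cong (false ∷_) (==ˢ⇒≡ u v h)

==ˢ-refl : ∀ {m} (u : Subset m) → T (u ==ˢ u)
==ˢ-refl [] = _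
==ˢ-refl (true ∷ u) = ==ˢ-refl u
==ˢ-refl (false ∷ u) = ==ˢ-refl u

∧-split : ∀ {x y} → T (x ∧ y) → T x × T y
∧-split = Equivalence.to T-∧

T-not⇒¬T : ∀ {b} → T (not b) → ¬ T b
T-not⇒¬T {false} _ ()

found : ∀ {m} (p : Subset m → Bool) (F : Family m) → T (any p F) → ∃[ A ] (A ∈ F × T (p A))
found p F = find ∘ any⁻ p F

distinctᵇ : ∀ {m} → Family m → Bool
distinctᵇ [] = true
distinctᵇ (A ∷ F) = not (any (A ==ˢ_) F) ∧ distinctᵇ F

distinctᵇ⇒distinct : ∀ {m} (F : Family m) → T (distinctᵇ F) → Distinct F
distinctᵇ⇒distinct [] _ = AllPairs.[]
distinctᵇ⇒distinct (A ∷ F) h with ∧-split h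
... | A∉F , rest = All.tabulate (λ B∈ A≡B → T-not⇒¬T A∉F (any⁺ _ (Any.map (λ B≡C → subst (T ∘ (A ==ˢ_)) (trans A≡B B≡C) (==ˢ-refl A)) B∈)))
                   AllPairs.∷ distinctᵇ⇒distinct F rest

unionsPresent : ∀ {m} → Family m → Bool
unionsPresent F = all (λ A → all (λ B → any ((A ∪ B) ==ˢ_) F) F) F

unionsPresent⇒unionClosed : ∀ {m} (F : Family m) → T (unionsPresent F) → UnionClosed F
unionsPresent⇒unionClosed F h A B A∈ B∈ with found _ F (All.lookup (all⁺ _ F (All.lookup (all⁺ _ F h) A∈)) B∈)
... | S , S∈ , A∪B==S = subst (_∈ F) (sym (==ˢ⇒≡ (A ∪ B) S A∪B==S)) S∈

attainedᵇ : ∀ {m} → Family m → ℕ → (ℕ → Bool) → Bool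
attainedᵇ F k bound = any (λ A → ∣ A ∣ ≡ᵇ k) F ∧ all (λ B → bound ∣ B ∣) F

attainedᵇ-sound : ∀ {m} (F : Family m) k {bound : ℕ → Bool} {Bound : ℕ → Set} → (∀ x → T (bound x) → Bound x) →
                  T (attainedᵇ F k bound) → ∃[ A ] ((A ∈ F × ∣ A ∣ ≡ k) × (∀ B → B ∈ F → Bound ∣ B ∣))
attainedᵇ-sound F k sound h with ∧-split h
... | attained , bounded with found _ F attained
...   | A , A∈ , ∣A∣≡k = A , (A∈ , ≡ᵇ⇒≡ _ k ∣A∣≡k) , λ B B∈ → sound ∣ B ∣ (All.lookup (all⁺ _ F bounded) B∈)

checkConstruction : ∀ {m} → Family m → ℕ → ℕ → ℕ → Bool
checkConstruction F f k n =
  distinctᵇ F ∧ unionsPresent F ∧ (frequentCount F ≡ᵇ f) ∧ attainedᵇ F k (k ≤ᵇ_) ∧ attainedᵇ F n (_≤ᵇ n)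

checkConstruction-sound : ∀ {m} (F : Family m) f k n → T (checkConstruction F f k n) → IsConstruction F f k n
checkConstruction-sound F f k n h with ∧-split h
... | dist , h₁ with ∧-split h₁
... | uc , h₂ with ∧-split h₂
... | freq , h₃ with ∧-split h₃
... | min , max = distinctᵇ⇒distinct F dist , unionsPresent⇒unionClosed F uc , ≡ᵇ⇒≡ _ f freq ,
                  attainedᵇ-sound F k (≤ᵇ⇒≤ k) min , attainedᵇ-sound F n (λ x → ≤ᵇ⇒≤ x n) max

separatedᵇ : ∀ {m} → Family m → Bool
separatedᵇ {m} F = all (λ a → all (λ b → isYes (a ≟ᶠ b) ∨ any (λ A → ∣ A ∩ (⁅ a ⁆ ∪ ⁅ b ⁆) ∣ ≡ᵇ 1) F) (allFin m)) (allFin m)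

separatedᵇ⇒twinFree : ∀ {m} (F : Family m) → T (separatedᵇ F) → TwinFree F
separatedᵇ⇒twinFree F h a b _ _ (a≢b , twins)
  with Equivalence.to T-∨ (All.lookup (all⁺ _ _ (All.lookup (all⁺ _ _ h) (∈-allFin a))) (∈-allFin b))
... | inj₁ a≡b = a≢b (toWitness {a? = a ≟ᶠ b} a≡b)
... | inj₂ separated with found _ F separated
...   | A , A∈ , ∣A∩ab∣≡1 = twins A A∈ (≡ᵇ⇒≡ _ 1 ∣A∩ab∣≡1)

-- Operations on constructions

∣b∷p∣ : ∀ {m} (b : Bool) (p : Subset m) → ∣ b ∷ p ∣ ≡ bit b + ∣ p ∣
∣b∷p∣ true p = refl
∣b∷p∣ false p = refl

∣p∣≡countFin : ∀ {n} (p : Subset n) → ∣ p ∣ ≡ countFin n (lookup p)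
∣p∣≡countFin [] = refl
∣p∣≡countFin (b ∷ p) = trans (∣b∷p∣ b p) (cong (bit b +_) (∣p∣≡countFin p))

∣p++q∣ : ∀ {a b} (p : Subset a) (q : Subset b) → ∣ p ++ᵛ q ∣ ≡ ∣ p ∣ + ∣ q ∣
∣p++q∣ [] q = refl
∣p++q∣ (x ∷ p) q = begin
  ∣ x ∷ (p ++ᵛ q) ∣       ≡⟨ ∣b∷p∣ x (p ++ᵛ q) ⟩
  bit x + ∣ p ++ᵛ q ∣      ≡⟨ cong (bit x +_) (∣p++q∣ p q) ⟩
  bit x + (∣ p ∣ + ∣ q ∣)  ≡⟨ +-assoc (bit x) _ _ ⟨
  bit x + ∣ p ∣ + ∣ q ∣    ≡⟨ cong (_+ ∣ q ∣) (∣b∷p∣ x p) ⟨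
  ∣ x ∷ p ∣ + ∣ q ∣ ∎
  where open ≡-Reasoning

MinSize⇒nonempty : ∀ {m} {F : Family m} {k} → MinSize F k → 0 < length F
MinSize⇒nonempty {F = _ ∷ _} _ = s≤s z≤n

doubled : ∀ {m} → Family m → Family (suc m)
doubled F = map (false ∷_) F ++ map (true ∷_) F

module _ {m} {F : Family m} where

  ∈-doubled⁺ : ∀ b {A} → A ∈ F → (b ∷ A) ∈ doubled F
  ∈-doubled⁺ false A∈ = ∈-++⁺ˡ (∈-map⁺ (false ∷_) A∈)
  ∈-doubled⁺ true A∈ = ∈-++⁺ʳ (map (false ∷_) F) (∈-map⁺ (true ∷_) A∈)

  ∈-doubled⁻ : ∀ {A} → A ∈ doubled F → ∃[ b ] ∃[ A₀ ] (A ≡ b ∷ A₀ × A₀ ∈ F)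
  ∈-doubled⁻ A∈ with ∈-++⁻ (map (false ∷_) F) A∈
  ... | inj₁ A∈₀ = let A₀ , A₀∈ , e = ∈-map⁻ (false ∷_) A∈₀ in false , A₀ , e , A₀∈
  ... | inj₂ A∈₁ = let A₀ , A₀∈ , e = ∈-map⁻ (true ∷_) A∈₁ in true , A₀ , e , A₀∈

  doubled-distinct : Distinct F → Distinct (doubled F)
  doubled-distinct u = Unique.++⁺ (Unique.map⁺ ∷-injectiveʳ u) (Unique.map⁺ ∷-injectiveʳ u) disjoint
    where
    disjoint : ∀ {A} → ¬ (A ∈ map (false ∷_) F × A ∈ map (true ∷_) F)
    disjoint (A∈₀ , A∈₁) with ∈-map⁻ (false ∷_) A∈₀ | ∈-map⁻ (true ∷_) A∈₁
    ... | _ , _ , refl | _ , _ , ()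

  doubled-unionClosed : UnionClosed F → UnionClosed (doubled F)
  doubled-unionClosed uc A B A∈ B∈ with ∈-doubled⁻ A∈ | ∈-doubled⁻ B∈
  ... | b , A₀ , refl , A₀∈ | c , B₀ , refl , B₀∈ = ∈-doubled⁺ (b ∨ c) (uc A₀ B₀ A₀∈ B₀∈)

  doubled-minSize : ∀ {k} → MinSize F k → MinSize (doubled F) k
  doubled-minSize (A , (A∈ , e) , bound) = false ∷ A , (∈-doubled⁺ false A∈ , e) , bound′
    where
    bound′ : ∀ B → B ∈ doubled F → _ ≤ ∣ B ∣
    bound′ B B∈ with ∈-doubled⁻ B∈
    ... | b , B₀ , refl , B₀∈ = ≤-trans (bound B₀ B₀∈) (∣p∣≤∣x∷p∣ b B₀)

  doubled-maxSize : ∀ {n} → MaxSize F n → MaxSize (doubled F) (suc n)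
  doubled-maxSize (A , (A∈ , e) , bound) = true ∷ A , (∈-doubled⁺ true A∈ , cong suc e) , bound′
    where
    bound′ : ∀ B → B ∈ doubled F → ∣ B ∣ ≤ suc _
    bound′ B B∈ with ∈-doubled⁻ B∈
    ... | b , B₀ , refl , B₀∈ = subst (_≤ suc _) (sym (∣b∷p∣ b B₀)) (+-mono-≤ (bit≤1 b) (bound B₀ B₀∈))
      where
      bit≤1 : ∀ b → bit b ≤ 1
      bit≤1 true = s≤s z≤n
      bit≤1 false = z≤n

  -- The new element lies in exactly half of the sets; every old element keeps its share.
  doubled-frequentCount : frequentCount (doubled F) ≡ frequentCount F
  doubled-frequentCount = begin
    frequentCount (doubled F)
      ≡⟨ frequentCount≡countFin (doubled F) ⟩
    bit (majority (length (doubled F)) (deg (doubled F) zero))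
      + countFin m (λ x → majority (length (doubled F)) (deg (doubled F) (suc x)))
      ≡⟨ cong₂ _+_ (cong bit (trans (cong₂ majority len deg-new) (majority-false (length F) (≤-reflexive (cong (length F +_) (+-identityʳ _))))))
                   (countFin-cong m (λ x → trans (cong₂ majority len (deg-old x)) (majority-double (length F) (deg F x)))) ⟩
    countFin m (λ x → majority (length F) (deg F x))
      ≡⟨ frequentCount≡countFin F ⟨
    frequentCount F ∎
    where
    open ≡-Reasoning
    len : length (doubled F) ≡ length F + length F
    len = trans (length-++ (map (false ∷_) F)) (cong₂ _+_ (length-map _ F) (length-map _ F))
    deg-new : deg (doubled F) zero ≡ length F
    deg-new = trans (count-++ _ (map (false ∷_) F) _)
      (cong₂ _+_ (trans (count-map _ _ F) (count-false F)) (trans (count-map _ _ F) (count-true F)))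
    deg-old : ∀ x → deg (doubled F) (suc x) ≡ deg F x + deg F x
    deg-old x = trans (count-++ _ (map (false ∷_) F) _) (cong₂ _+_ (count-map _ _ F) (count-map _ _ F))

  old-element : ∀ {i} → ElementOf (suc i) (doubled F) → ElementOf i F
  old-element (A , A∈ , i∈A) with ∈-doubled⁻ A∈
  ... | b , A₀ , refl , A₀∈ with i∈A
  ...   | there i∈A₀ = A₀ , A₀∈ , i∈A₀

  doubled-twinFree : TwinFree F → TwinFree (doubled F)
  doubled-twinFree tf zero zero _ _ (0≢0 , _) = 0≢0 refl
  doubled-twinFree tf zero (suc j) _ j∈ tw with old-element j∈
  ... | A , A∈ , j∈A = separated⇒¬Twins (∈-doubled⁺ false A∈) (there j∈A) (λ ()) (Twins-sym tw)
  doubled-twinFree tf (suc i) zero i∈ _ tw with old-element i∈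
  ... | A , A∈ , i∈A = separated⇒¬Twins (∈-doubled⁺ false A∈) (there i∈A) (λ ()) tw
  doubled-twinFree tf (suc i) (suc j) i∈ j∈ (i≢j , tw) =
    tf i j (old-element i∈) (old-element j∈) ((λ i≡j → i≢j (cong suc i≡j)) , λ S S∈ → tw (false ∷ S) (∈-doubled⁺ false S∈))

lift-≤ : ∀ {P : ℕ → Set} → (∀ {n} → P n → P (suc n)) → ∀ {n n′} → n ≤ n′ → P n → P n′
lift-≤ {P} step n≤n′ = go (≤⇒≤′ n≤n′)
  where
  go : ∀ {n n′} → n ≤′ n′ → P n → P n′
  go ≤′-refl p = p
  go (≤′-step h) p = step (go h p)

doubled-isConstruction : ∀ {m} {F : Family m} {f k n} → IsConstruction F f k n → IsConstruction (doubled F) f k (suc n)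
doubled-isConstruction {F = F} (u , uc , fc , min , max) =
  doubled-distinct u , doubled-unionClosed uc , trans (doubled-frequentCount {F = F}) fc , doubled-minSize min , doubled-maxSize max

Construction-suc : ∀ {f k n} → Construction f k n → Construction f k (suc n)
Construction-suc (m , F , c) = suc m , doubled F , doubled-isConstruction c

TwinFreeConstruction-suc : ∀ {f k n} → TwinFreeConstruction f k n → TwinFreeConstruction f k (suc n)
TwinFreeConstruction-suc (m , F , c , tf) = suc m , doubled F , doubled-isConstruction c , doubled-twinFree tf

Construction-mono : ∀ {f k n n′} → n ≤ n′ → Construction f k n → Construction f k n′
Construction-mono = lift-≤ Construction-suc

TwinFreeConstruction⇒Construction : ∀ {f k n} → TwinFreeConstruction f k n → Construction f k n
TwinFreeConstruction⇒Construction (m , F , c , _) = m , F , c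

withUniversal : ∀ {m} → Family m → Family (suc m)
withUniversal F = map (true ∷_) F

module _ {m} {F : Family m} where

  withUniversal-unionClosed : UnionClosed F → UnionClosed (withUniversal F)
  withUniversal-unionClosed uc A B A∈ B∈ with ∈-map⁻ (true ∷_) A∈ | ∈-map⁻ (true ∷_) B∈
  ... | A₀ , A₀∈ , refl | B₀ , B₀∈ , refl = ∈-map⁺ (true ∷_) (uc A₀ B₀ A₀∈ B₀∈)

  withUniversal-minSize : ∀ {k} → MinSize F k → MinSize (withUniversal F) (suc k)
  withUniversal-minSize (A , (A∈ , e) , bound) = true ∷ A , (∈-map⁺ (true ∷_) A∈ , cong suc e) , bound′
    where
    bound′ : ∀ B → B ∈ withUniversal F → suc _ ≤ ∣ B ∣
    bound′ B B∈ with ∈-map⁻ (true ∷_) B∈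
    ... | B₀ , B₀∈ , refl = s≤s (bound B₀ B₀∈)

  withUniversal-maxSize : ∀ {n} → MaxSize F n → MaxSize (withUniversal F) (suc n)
  withUniversal-maxSize (A , (A∈ , e) , bound) = true ∷ A , (∈-map⁺ (true ∷_) A∈ , cong suc e) , bound′
    where
    bound′ : ∀ B → B ∈ withUniversal F → ∣ B ∣ ≤ suc _
    bound′ B B∈ with ∈-map⁻ (true ∷_) B∈
    ... | B₀ , B₀∈ , refl = s≤s (bound B₀ B₀∈)

  withUniversal-frequentCount : 0 < length F → frequentCount (withUniversal F) ≡ suc (frequentCount F)
  withUniversal-frequentCount F≢[] = begin
    frequentCount (withUniversal F)
      ≡⟨ frequentCount≡countFin (withUniversal F) ⟩
    bit (majority (length (withUniversal F)) (deg (withUniversal F) zero))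
      + countFin m (λ x → majority (length (withUniversal F)) (deg (withUniversal F) (suc x)))
      ≡⟨ cong₂ _+_ (cong bit (trans (cong₂ majority len deg-new) (majority-true (length F) (m<m+n (length F) F≢[]′))))
                   (countFin-cong m (λ x → cong₂ majority len (count-map _ _ F))) ⟩
    suc (countFin m (λ x → majority (length F) (deg F x)))
      ≡⟨ cong suc (frequentCount≡countFin F) ⟨
    suc (frequentCount F) ∎
    where
    open ≡-Reasoning
    len : length (withUniversal F) ≡ length F
    len = length-map _ F
    deg-new : deg (withUniversal F) zero ≡ length F
    deg-new = trans (count-map _ _ F) (count-true F)
    F≢[]′ : 0 < length F + 0
    F≢[]′ = subst (0 <_) (sym (+-identityʳ _)) F≢[]

Construction-withUniversal : ∀ {f k n} → Construction f k n → Construction (suc f) (suc k) (suc n)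
Construction-withUniversal (m , F , u , uc , fc , min , max) =
  suc m , withUniversal F , Unique.map⁺ ∷-injectiveʳ u , withUniversal-unionClosed uc ,
  trans (withUniversal-frequentCount {F = F} (MinSize⇒nonempty min)) (cong suc fc) ,
  withUniversal-minSize min , withUniversal-maxSize max

Construction-withUniversal^ : ∀ j {f k n} → Construction f k n → Construction (j + f) (j + k) (j + n)
Construction-withUniversal^ zero c = c
Construction-withUniversal^ (suc j) c = Construction-withUniversal (Construction-withUniversal^ j c)

-- Blowing up elements

-- Element i is replaced by 1 + ω i copies; keeping every element means distinct sets stay distinct.
total : ∀ {m} → Vec ℕ m → ℕ
total [] = 0
total (w ∷ ω) = suc (w + total ω)

blowUp : ∀ {m} (ω : Vec ℕ m) → Subset m → Subset (total ω)
blowUp [] [] = []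
blowUp (w ∷ ω) (b ∷ s) = b ∷ (replicate w b ++ᵛ blowUp ω s)

origin : ∀ {m} (ω : Vec ℕ m) → Fin (total ω) → Fin m
origin (w ∷ ω) zero = zero
origin (w ∷ ω) (suc x) = [ const zero , suc ∘ origin ω ] (splitAt w x)

weight : ∀ {m} → Vec ℕ m → (Fin m → Bool) → ℕ
weight [] p = 0
weight (w ∷ ω) p = bit (p zero) * suc w + weight ω (p ∘ suc)

weight-cong : ∀ {m} (ω : Vec ℕ m) {p q : Fin m → Bool} → (∀ i → p i ≡ q i) → weight ω p ≡ weight ω q
weight-cong [] _ = refl
weight-cong (w ∷ ω) p≗q = cong₂ _+_ (cong (λ b → bit b * suc w) (p≗q zero)) (weight-cong ω (p≗q ∘ suc))

lookup-blowUp : ∀ {m} (ω : Vec ℕ m) s x → lookup (blowUp ω s) x ≡ lookup s (origin ω x)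
lookup-blowUp (w ∷ ω) (b ∷ s) zero = refl
lookup-blowUp (w ∷ ω) (b ∷ s) (suc x) with splitAt w x in eq
... | inj₁ i = begin
  lookup (replicate w b ++ᵛ blowUp ω s) x          ≡⟨ cong (lookup (replicate w b ++ᵛ blowUp ω s)) (splitAt⁻¹-↑ˡ eq) ⟨
  lookup (replicate w b ++ᵛ blowUp ω s) (i ↑ˡ _)   ≡⟨ lookup-++ˡ (replicate w b) (blowUp ω s) i ⟩
  lookup (replicate w b) i                        ≡⟨ lookup-replicate i b ⟩
  b ∎
  where open ≡-Reasoning
... | inj₂ j = begin
  lookup (replicate w b ++ᵛ blowUp ω s) x          ≡⟨ cong (lookup (replicate w b ++ᵛ blowUp ω s)) (splitAt⁻¹-↑ʳ eq) ⟨
  lookup (replicate w b ++ᵛ blowUp ω s) (w ↑ʳ j)   ≡⟨ lookup-++ʳ (replicate w b) (blowUp ω s) j ⟩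
  lookup (blowUp ω s) j                           ≡⟨ lookup-blowUp ω s j ⟩
  lookup s (origin ω j) ∎
  where open ≡-Reasoning

countFin-++ : ∀ a b (p : Fin (a + b) → Bool) → countFin (a + b) p ≡ countFin a (p ∘ (_↑ˡ b)) + countFin b (p ∘ (a ↑ʳ_))
countFin-++ zero b p = refl
countFin-++ (suc a) b p = trans (cong (bit (p zero) +_) (countFin-++ a b (p ∘ suc))) (sym (+-assoc (bit (p zero)) _ _))

countFin-const : ∀ n b → countFin n (const b) ≡ bit b * n
countFin-const zero b = sym (*-zeroʳ (bit b))
countFin-const (suc n) b = trans (cong (bit b +_) (countFin-const n b)) (sym (*-suc (bit b) n))

countFin-origin : ∀ {m} (ω : Vec ℕ m) (p : Fin m → Bool) → countFin (total ω) (p ∘ origin ω) ≡ weight ω p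
countFin-origin [] p = refl
countFin-origin (w ∷ ω) p = begin
  bit (p zero) + countFin (w + total ω) (p ∘ origin (w ∷ ω) ∘ suc)
    ≡⟨ cong (bit (p zero) +_) (countFin-++ w (total ω) _) ⟩
  bit (p zero) + (countFin w (p ∘ origin (w ∷ ω) ∘ suc ∘ (_↑ˡ total ω))
                  + countFin (total ω) (p ∘ origin (w ∷ ω) ∘ suc ∘ (w ↑ʳ_)))
    ≡⟨ cong (bit (p zero) +_) (cong₂ _+_ (countFin-cong w (λ i → cong p′ (splitAt-↑ˡ w i (total ω))))
                                        (countFin-cong (total ω) (λ j → cong p′ (splitAt-↑ʳ w (total ω) j)))) ⟩
  bit (p zero) + (countFin w (const (p zero)) + countFin (total ω) (p ∘ suc ∘ origin ω))
    ≡⟨ cong (bit (p zero) +_) (cong₂ _+_ (countFin-const w (p zero)) (countFin-origin ω (p ∘ suc))) ⟩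
  bit (p zero) + (bit (p zero) * w + weight ω (p ∘ suc))
    ≡⟨ +-assoc (bit (p zero)) _ _ ⟨
  bit (p zero) + bit (p zero) * w + weight ω (p ∘ suc)
    ≡⟨ cong (_+ weight ω (p ∘ suc)) (*-suc (bit (p zero)) w) ⟨
  bit (p zero) * suc w + weight ω (p ∘ suc) ∎
  where
  open ≡-Reasoning
  p′ = λ r → p ([ const zero , suc ∘ origin ω ] r)

∣blowUp∣ : ∀ {m} (ω : Vec ℕ m) s → ∣ blowUp ω s ∣ ≡ weight ω (lookup s)
∣blowUp∣ ω s = trans (∣p∣≡countFin (blowUp ω s))
                     (trans (countFin-cong (total ω) (lookup-blowUp ω s)) (countFin-origin ω (lookup s)))

blowUp-∪ : ∀ {m} (ω : Vec ℕ m) s t → blowUp ω (s ∪ t) ≡ blowUp ω s ∪ blowUp ω t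
blowUp-∪ [] [] [] = refl
blowUp-∪ (w ∷ ω) (b ∷ s) (c ∷ t) = cong ((b ∨ c) ∷_) (begin
  replicate w (b ∨ c) ++ᵛ blowUp ω (s ∪ t)
    ≡⟨ cong₂ _++ᵛ_ (zipWith-replicate _∨_ b c) (sym (blowUp-∪ ω s t)) ⟨
  (replicate w b ∪ replicate w c) ++ᵛ (blowUp ω s ∪ blowUp ω t)
    ≡⟨ zipWith-++ _∨_ (replicate w b) (blowUp ω s) (replicate w c) (blowUp ω t) ⟨
  (replicate w b ++ᵛ blowUp ω s) ∪ (replicate w c ++ᵛ blowUp ω t) ∎)
  where open ≡-Reasoning

blowUp-injective : ∀ {m} (ω : Vec ℕ m) {s t} → blowUp ω s ≡ blowUp ω t → s ≡ t
blowUp-injective [] {[]} {[]} _ = refl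
blowUp-injective (w ∷ ω) {b ∷ s} {c ∷ t} e with ∷-injectiveˡ e
... | refl = cong (b ∷_) (blowUp-injective ω (++-injectiveʳ (replicate w b) (replicate w b) (∷-injectiveʳ e)))

module _ {m} (ω : Vec ℕ m) (F : Family m) where

  blowUp-frequentCount : frequentCount (map (blowUp ω) F) ≡ weight ω (λ i → majority (length F) (deg F i))
  blowUp-frequentCount =
    trans (frequentCount≡countFin (map (blowUp ω) F))
          (trans (countFin-cong (total ω) (λ x → cong₂ majority (length-map (blowUp ω) F) (deg-blowUp x)))
                 (countFin-origin ω _))
    where
    deg-blowUp : ∀ x → deg (map (blowUp ω) F) x ≡ deg F (origin ω x)
    deg-blowUp x = trans (count-map _ (blowUp ω) F) (count-cong F (λ s → lookup-blowUp ω s x))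

  blowUp-distinct : Distinct F → Distinct (map (blowUp ω) F)
  blowUp-distinct = Unique.map⁺ (blowUp-injective ω)

  blowUp-unionClosed : UnionClosed F → UnionClosed (map (blowUp ω) F)
  blowUp-unionClosed uc A B A∈ B∈ with ∈-map⁻ (blowUp ω) A∈ | ∈-map⁻ (blowUp ω) B∈
  ... | s , s∈ , refl | t , t∈ , refl = subst (_∈ map (blowUp ω) F) (blowUp-∪ ω s t) (∈-map⁺ (blowUp ω) (uc s t s∈ t∈))

  blowUp-minSize : ∀ {k} → (∃[ s ] (s ∈ F × weight ω (lookup s) ≡ k)) → (∀ s → s ∈ F → k ≤ weight ω (lookup s)) →
                   MinSize (map (blowUp ω) F) k
  blowUp-minSize (s , s∈ , e) bound = blowUp ω s , (∈-map⁺ (blowUp ω) s∈ , trans (∣blowUp∣ ω s) e) , bound′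
    where
    bound′ : ∀ B → B ∈ map (blowUp ω) F → _ ≤ ∣ B ∣
    bound′ B B∈ with ∈-map⁻ (blowUp ω) B∈
    ... | t , t∈ , refl = subst (_ ≤_) (sym (∣blowUp∣ ω t)) (bound t t∈)

  blowUp-maxSize : ⊤ ∈ F → MaxSize (map (blowUp ω) F) (total ω)
  blowUp-maxSize ⊤∈ = blowUp ω ⊤ , (∈-map⁺ (blowUp ω) ⊤∈ , trans (cong ∣_∣ (blowUp-⊤ ω)) (∣⊤∣≡n (total ω))) , λ B _ → ∣p∣≤n B
    where
    blowUp-⊤ : ∀ {m} (ω : Vec ℕ m) → blowUp ω ⊤ ≡ ⊤
    blowUp-⊤ [] = refl
    blowUp-⊤ (w ∷ ω) = cong (true ∷_) (trans (cong (replicate w true ++ᵛ_) (blowUp-⊤ ω)) (replicate-++ w))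
      where
      replicate-++ : ∀ w {n} → replicate w true ++ᵛ replicate n true ≡ replicate (w + n) true
      replicate-++ zero = refl
      replicate-++ (suc w) = cong (true ∷_) (replicate-++ w)

-- Subsets counted by size

subsets : ∀ d → Family d
subsets zero = [] ∷ []
subsets (suc d) = doubled (subsets d)

∈-subsets : ∀ {d} (s : Subset d) → s ∈ subsets d
∈-subsets [] = Any.here refl
∈-subsets (b ∷ s) = ∈-doubled⁺ b (∈-subsets s)

subsets-distinct : ∀ d → Distinct (subsets d)
subsets-distinct zero = All.[] AllPairs.∷ AllPairs.[]
subsets-distinct (suc d) = doubled-distinct (subsets-distinct d)

subsetsOfSize≥ : ∀ d → ℕ → Family d
subsetsOfSize≥ d j = filter (λ s → j ≤? ∣ s ∣) (subsets d)

∈-subsetsOfSize≥⁺ : ∀ {d j} {s : Subset d} → j ≤ ∣ s ∣ → s ∈ subsetsOfSize≥ d j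
∈-subsetsOfSize≥⁺ {s = s} = ∈-filter⁺ _ (∈-subsets s)

∈-subsetsOfSize≥⁻ : ∀ {d j} {s : Subset d} → s ∈ subsetsOfSize≥ d j → j ≤ ∣ s ∣
∈-subsetsOfSize≥⁻ {d} {j} = proj₂ ∘ ∈-filter⁻ (λ s → j ≤? ∣ s ∣) {xs = subsets d}

subsetsOfSize≥-distinct : ∀ d j → Distinct (subsetsOfSize≥ d j)
subsetsOfSize≥-distinct d j = Unique.filter⁺ _ (subsets-distinct d)

count-subsetsOfSize≥ : ∀ d j q → count q (subsetsOfSize≥ d j) ≡ count (λ s → (j ≤ᵇ ∣ s ∣) ∧ q s) (subsets d)
count-subsetsOfSize≥ d j q = count-filter (λ s → j ≤? ∣ s ∣) q (subsets d)

countBySize : ∀ d → (ℕ → Bool) → ℕ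
countBySize d P = count (P ∘ ∣_∣) (subsets d)

countBySize-suc : ∀ d P → countBySize (suc d) P ≡ countBySize d P + countBySize d (P ∘ suc)
countBySize-suc d P = trans (count-++ _ (map (false ∷_) (subsets d)) _)
                            (cong₂ _+_ (count-map _ _ (subsets d)) (count-map _ _ (subsets d)))

-- Subsets of Fin (suc e) containing i correspond to subsets of the other e elements, one element larger.
countBySize-∋ : ∀ e (i : Fin (suc e)) P → count (λ s → lookup s i ∧ P ∣ s ∣) (subsets (suc e)) ≡ countBySize e (P ∘ suc)
countBySize-∋ e zero P = trans (count-++ _ (map (false ∷_) (subsets e)) _)
  (cong₂ _+_ (trans (count-map _ _ (subsets e)) (count-false (subsets e))) (count-map _ _ (subsets e)))
countBySize-∋ (suc e) (suc i) P = begin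
  count (λ s → lookup s (suc i) ∧ P ∣ s ∣) (subsets (suc (suc e)))
    ≡⟨ trans (count-++ _ (map (false ∷_) (subsets (suc e))) _)
             (cong₂ _+_ (count-map _ _ (subsets (suc e))) (count-map _ _ (subsets (suc e)))) ⟩
  count (λ s → lookup s i ∧ P ∣ s ∣) (subsets (suc e)) + count (λ s → lookup s i ∧ P (suc ∣ s ∣)) (subsets (suc e))
    ≡⟨ cong₂ _+_ (countBySize-∋ e i P) (countBySize-∋ e i (λ x → P (suc x))) ⟩
  countBySize e (λ x → P (suc x)) + countBySize e (λ x → P (suc (suc x)))
    ≡⟨ countBySize-suc e (λ x → P (suc x)) ⟨
  countBySize (suc e) (λ x → P (suc x)) ∎
  where open ≡-Reasoning

atLeast : ℕ → ℕ → ℕ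
atLeast d j = countBySize d (j ≤ᵇ_)

length-subsetsOfSize≥ : ∀ d j → length (subsetsOfSize≥ d j) ≡ atLeast d j
length-subsetsOfSize≥ d j = trans (sym (count-true (subsetsOfSize≥ d j))) (trans (count-subsetsOfSize≥ d j _) (count-∧-true _ (subsets d)))

suc≤ᵇsuc : ∀ j x → (suc j ≤ᵇ suc x) ≡ (j ≤ᵇ x)
suc≤ᵇsuc zero x = refl
suc≤ᵇsuc (suc j) x = refl

atLeast-pos : ∀ {d j} → j ≤ d → 0 < atLeast d j
atLeast-pos {d} {j} j≤d = count-pos (λ s → j ≤ᵇ ∣ s ∣) (∈-subsets (⊤ {d})) (≤⇒≤ᵇ (subst (j ≤_) (sym (∣⊤∣≡n d)) j≤d))

deg-subsetsOfSize≥ : ∀ {d j m} (f : Subset d → Subset m) x →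
                     deg (map f (subsetsOfSize≥ d j)) x ≡ count (λ s → (j ≤ᵇ ∣ s ∣) ∧ lookup (f s) x) (subsets d)
deg-subsetsOfSize≥ {d} {j} f x = trans (count-map _ f (subsetsOfSize≥ d j)) (count-subsetsOfSize≥ d j _)

deg-all : ∀ {n j m} (f : Subset n → Subset m) x → (∀ s → lookup (f s) x ≡ true) →
          deg (map f (subsetsOfSize≥ n j)) x ≡ atLeast n j
deg-all {n} f x f∋x = trans (deg-subsetsOfSize≥ f x) (trans (count-cong (subsets n) (λ s → cong (_ ∧_) (f∋x s))) (count-∧-true _ (subsets n)))

deg-none : ∀ {n j m} (f : Subset n → Subset m) x → (∀ s → lookup (f s) x ≡ false) →
           deg (map f (subsetsOfSize≥ n j)) x ≡ 0
deg-none {n} f x f∌x = trans (deg-subsetsOfSize≥ f x) (trans (count-cong (subsets n) (λ s → cong (_ ∧_) (f∌x s))) (count-∧-false _ (subsets n)))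

atLeast-suc : ∀ d j → atLeast (suc d) (suc j) ≡ atLeast d (suc j) + atLeast d j
atLeast-suc d j = trans (countBySize-suc d (suc j ≤ᵇ_)) (cong (atLeast d (suc j) +_) (count-cong (subsets d) (suc≤ᵇsuc j ∘ ∣_∣)))

atLeast-∋ : ∀ e (i : Fin (suc e)) j → count (λ s → (suc j ≤ᵇ ∣ s ∣) ∧ lookup s i) (subsets (suc e)) ≡ atLeast e j
atLeast-∋ e i j = begin
  count (λ s → (suc j ≤ᵇ ∣ s ∣) ∧ lookup s i) (subsets (suc e))
    ≡⟨ count-cong (subsets (suc e)) (λ s → ∧-comm (suc j ≤ᵇ ∣ s ∣) (lookup s i)) ⟩
  count (λ s → lookup s i ∧ (suc j ≤ᵇ ∣ s ∣)) (subsets (suc e))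
    ≡⟨ countBySize-∋ e i (suc j ≤ᵇ_) ⟩
  countBySize e (λ x → suc j ≤ᵇ suc x)
    ≡⟨ count-cong (subsets e) (suc≤ᵇsuc j ∘ ∣_∣) ⟩
  atLeast e j ∎
  where open ≡-Reasoning

atLeast-zero : ∀ {d j} → d < j → atLeast d j ≡ 0
atLeast-zero {zero} {suc j} _ = refl
atLeast-zero {suc d} {suc j} (s≤s d<j) =
  trans (atLeast-suc d j) (cong₂ _+_ (atLeast-zero (m≤n⇒m≤1+n d<j)) (atLeast-zero d<j))

atLeast-pos⁻ : ∀ {d j} → 0 < atLeast d j → j ≤ d
atLeast-pos⁻ {d} {j} 0<atLeast with j ≤? d
... | yes j≤d = j≤d
... | no j≰d = contradiction (subst (0 <_) (atLeast-zero (≰⇒> j≰d)) 0<atLeast) (λ ())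

choose : ℕ → ℕ → ℕ
choose n zero = 1
choose zero (suc j) = 0
choose (suc n) (suc j) = choose n j + choose n (suc j)

choose≡C : ∀ n j → choose n j ≡ n C j
choose≡C zero zero = refl
choose≡C zero (suc j) = refl
choose≡C (suc n) zero = refl
choose≡C (suc n) (suc j) = trans (cong₂ _+_ (choose≡C n j) (choose≡C n (suc j))) (nCk+nC[k+1]≡[n+1]C[k+1] n j)

atLeast-choose : ∀ d j → atLeast d j ≡ choose d j + atLeast d (suc j)
atLeast-choose zero zero = refl
atLeast-choose zero (suc j) = refl
atLeast-choose (suc d) zero = begin
  atLeast (suc d) 0                     ≡⟨ countBySize-suc d (0 ≤ᵇ_) ⟩
  atLeast d 0 + atLeast d 0             ≡⟨ cong (_+ atLeast d 0) (atLeast-choose d 0) ⟩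
  1 + atLeast d 1 + atLeast d 0         ≡⟨ +-assoc 1 (atLeast d 1) (atLeast d 0) ⟩
  1 + (atLeast d 1 + atLeast d 0)       ≡⟨ cong (1 +_) (atLeast-suc d 0) ⟨
  1 + atLeast (suc d) 1 ∎
  where open ≡-Reasoning
atLeast-choose (suc d) (suc j) = begin
  atLeast (suc d) (suc j)
    ≡⟨ atLeast-suc d j ⟩
  atLeast d (suc j) + atLeast d j
    ≡⟨ cong₂ _+_ (atLeast-choose d (suc j)) (atLeast-choose d j) ⟩
  (choose d (suc j) + atLeast d (suc (suc j))) + (choose d j + atLeast d (suc j))
    ≡⟨ solve 4 (λ a b c e → (a :+ b) :+ (c :+ e) := (c :+ a) :+ (b :+ e)) refl
               (choose d (suc j)) (atLeast d (suc (suc j))) (choose d j) (atLeast d (suc j)) ⟩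
  (choose d j + choose d (suc j)) + (atLeast d (suc (suc j)) + atLeast d (suc j))
    ≡⟨ cong (choose (suc d) (suc j) +_) (atLeast-suc d (suc j)) ⟨
  choose (suc d) (suc j) + atLeast (suc d) (suc (suc j)) ∎
  where
  open ≡-Reasoning
  open +-*-Solver

choose≤atLeast : ∀ d j → choose d j ≤ atLeast d j
choose≤atLeast d j = ≤-trans (m≤m+n (choose d j) (atLeast d (suc j))) (≤-reflexive (sym (atLeast-choose d j)))

sumFromTo-C≡atLeast : ∀ j d → sumFromTo j d (d C_) ≡ atLeast d j
sumFromTo-C≡atLeast j d with j ≤? suc d
... | yes j≤1+d = trans (cong sum (map-applyUpTo (λ t → t) _ (suc d ∸ j)))
                        (tail (suc d ∸ j) j (λ t → j + t) (λ t → refl) (m+[n∸m]≡n j≤1+d))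
  where
  tail : ∀ r j (f : ℕ → ℕ) → (∀ t → f t ≡ j + t) → j + r ≡ suc d → sum (applyUpTo (λ t → d C f t) r) ≡ atLeast d j
  tail zero j f f≗ j≡1+d = sym (atLeast-zero (≤-reflexive (trans (sym j≡1+d) (+-identityʳ j))))
  tail (suc r) j f f≗ j+r≡ = begin
    d C f 0 + sum (applyUpTo (λ t → d C f (suc t)) r)
      ≡⟨ cong₂ _+_ (cong (d C_) (trans (f≗ 0) (+-identityʳ j)))
                   (tail r (suc j) (f ∘ suc) (λ t → trans (f≗ (suc t)) (+-suc j t)) (trans (sym (+-suc j r)) j+r≡)) ⟩
    d C j + atLeast d (suc j)
      ≡⟨ cong (_+ atLeast d (suc j)) (choose≡C d j) ⟨
    choose d j + atLeast d (suc j)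
      ≡⟨ atLeast-choose d j ⟨
    atLeast d j ∎
    where open ≡-Reasoning
... | no j≰1+d = trans (cong (λ r → sum (map (λ t → d C (j + t)) (upTo r))) (m≤n⇒m∸n≡0 (<⇒≤ (≰⇒> j≰1+d))))
                       (sym (atLeast-zero (<-trans (n<1+n d) (≰⇒> j≰1+d))))

choose-mono-suc : ∀ n j → choose n j ≤ choose (suc n) j
choose-mono-suc n zero = ≤-refl
choose-mono-suc n (suc j) = m≤n+m (choose n (suc j)) (choose n j)

choose-monoˡ : ∀ {n n′} j → n ≤ n′ → choose n j ≤ choose n′ j
choose-monoˡ {n} j n≤n′ = lift-≤ {P = λ m → choose n j ≤ choose m j} (λ {m} h → ≤-trans h (choose-mono-suc m j)) n≤n′ ≤-refl

choose≤^ : ∀ n j → choose n j ≤ n ^ j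
choose≤^ n zero = ≤-refl
choose≤^ zero (suc j) = z≤n
choose≤^ (suc n) (suc j) = begin
  choose n j + choose n (suc j)   ≤⟨ +-mono-≤ (choose≤^ n j) (choose≤^ n (suc j)) ⟩
  n ^ j + n * n ^ j               ≤⟨ +-mono-≤ (^-monoˡ-≤ j (n≤1+n n)) (*-monoʳ-≤ n (^-monoˡ-≤ j (n≤1+n n))) ⟩
  suc n ^ j + n * suc n ^ j ∎
  where open ≤-Reasoning

-- A crude Vandermonde inequality: choosing j from m and l from n is one way of choosing j + l from m + n.
choose*choose≤choose : ∀ m n j l → choose m j * choose n l ≤ choose (m + n) (j + l)
choose*choose≤choose zero n zero l = ≤-reflexive (+-identityʳ (choose n l))
choose*choose≤choose zero n (suc j) l = z≤n
choose*choose≤choose (suc m) n zero l = ≤-trans (≤-reflexive (+-identityʳ (choose n l))) (choose-monoˡ l (m≤n+m n (suc m)))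
choose*choose≤choose (suc m) n (suc j) l = begin
  (choose m j + choose m (suc j)) * choose n l                  ≡⟨ *-distribʳ-+ (choose n l) (choose m j) _ ⟩
  choose m j * choose n l + choose m (suc j) * choose n l       ≤⟨ +-mono-≤ (choose*choose≤choose m n j l) (choose*choose≤choose m n (suc j) l) ⟩
  choose (m + n) (j + l) + choose (m + n) (suc j + l) ∎
  where open ≤-Reasoning

^≤choose : ∀ j x → x ^ j ≤ choose (j * x) j
^≤choose zero x = ≤-refl
^≤choose (suc j) x = begin
  x * x ^ j                       ≡⟨ cong (_* x ^ j) (choose-1 x) ⟨
  choose x 1 * x ^ j              ≤⟨ *-monoʳ-≤ (choose x 1) (^≤choose j x) ⟩
  choose x 1 * choose (j * x) j   ≤⟨ choose*choose≤choose x (j * x) 1 j ⟩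
  choose (x + j * x) (suc j) ∎
  where
  open ≤-Reasoning
  choose-1 : ∀ x → choose x 1 ≡ x
  choose-1 zero = refl
  choose-1 (suc x) = cong suc (choose-1 x)

^-distribʳ-* : ∀ a b c → (a * b) ^ c ≡ a ^ c * b ^ c
^-distribʳ-* a b zero = refl
^-distribʳ-* a b (suc c) = trans (cong ((a * b) *_) (^-distribʳ-* a b c))
  (solve 4 (λ a b p q → (a :* b) :* (p :* q) := (a :* p) :* (b :* q)) refl a b (a ^ c) (b ^ c))
  where open +-*-Solver

1≤^ : ∀ {x} c → 1 ≤ x → 1 ≤ x ^ c
1≤^ zero _ = ≤-refl
1≤^ (suc c) 1≤x = *-mono-≤ 1≤x (1≤^ c 1≤x)

data Halves : ℕ → Set where
  even : ∀ h → Halves (h + h)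
  odd : ∀ h → Halves (suc (h + h))

halves : ∀ n → Halves n
halves zero = even 0
halves (suc n) with halves n
... | even h = odd h
... | odd h = subst Halves (cong suc (+-suc h h)) (even (suc h))

half-even : ∀ h → (h + h) / 2 ≡ h
half-even zero = refl
half-even (suc h) = begin
  (suc h + suc h) / 2      ≡⟨ cong (λ x → suc x / 2) (+-suc h h) ⟩
  suc (suc (h + h)) / 2    ≡⟨ m/n≡1+[m∸n]/n {suc (suc (h + h))} {2} (s≤s (s≤s z≤n)) ⟩
  suc ((h + h) / 2)        ≡⟨ cong suc (half-even h) ⟩
  suc h ∎
  where open ≡-Reasoning

half-odd : ∀ h → suc (h + h) / 2 ≡ h
half-odd zero = refl
half-odd (suc h) = begin
  suc (suc h + suc h) / 2    ≡⟨ cong (λ x → suc (suc x) / 2) (+-suc h h) ⟩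
  suc (suc (suc (h + h))) / 2 ≡⟨ m/n≡1+[m∸n]/n {suc (suc (suc (h + h)))} {2} (s≤s (s≤s z≤n)) ⟩
  suc (suc (h + h) / 2)     ≡⟨ cong suc (half-odd h) ⟩
  suc h ∎
  where open ≡-Reasoning

double-≤ : ∀ a b → a + a ≤ suc (b + b) → a ≤ b
double-≤ zero b _ = z≤n
double-≤ (suc a) zero (s≤s h) = contradiction (subst (_≤ 0) (+-suc a a) h) (λ ())
double-≤ (suc a) (suc b) (s≤s h) = s≤s (double-≤ a b (≤-pred (subst₂ _≤_ (+-suc a a) (cong suc (+-suc b b)) h)))

2∤odd : ∀ h → ¬ 2 ∣ suc (h + h)
2∤odd h (divides q 1+2h≡2q) = contradiction (begin
  1                         ≡⟨ [m+kn]%n≡m%n 1 h 2 ⟨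
  (1 + h * 2) % 2           ≡⟨ cong (_% 2) (trans (cong suc (solve 1 (λ h → h :* con 2 := h :+ h) refl h)) 1+2h≡2q) ⟩
  (q * 2) % 2               ≡⟨ m*n%n≡0 q 2 ⟩
  0 ∎) (λ ())
  where
  open ≡-Reasoning
  open +-*-Solver

∸-cancel : ∀ {a} b c → a ≡ b + c → a ∸ c ≡ b
∸-cancel b c refl = m+n∸n≡m b c

-- The template family

initialSegment : ∀ n j → j ≤ n → Subset n
initialSegment n zero _ = ⊥
initialSegment (suc n) (suc j) (s≤s j≤n) = true ∷ initialSegment n j j≤n

∣initialSegment∣ : ∀ n j (j≤n : j ≤ n) → ∣ initialSegment n j j≤n ∣ ≡ j
∣initialSegment∣ n zero _ = ∣⊥∣≡0 n
∣initialSegment∣ (suc n) (suc j) (s≤s j≤n) = cong suc (∣initialSegment∣ n j j≤n)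

-- Here d = 1 + e and k = 3 + c; element 0 is a, element 1 is b, then come Y and Z.
module Template (c e : ℕ) where

  d : ℕ
  d = suc e

  onlyA : Subset d → Subset (2 + (d + d))
  onlyA y = true ∷ false ∷ (y ++ᵛ ⊥ {d})

  onlyB : Subset d → Subset (2 + (d + d))
  onlyB z = false ∷ true ∷ (⊥ {d} ++ᵛ z)

  both : Subset (d + d) → Subset (2 + (d + d))
  both w = true ∷ true ∷ w

  familyA familyB familyAB template : Family (2 + (d + d))
  familyA = map onlyA (subsetsOfSize≥ d (2 + c))
  familyB = map onlyB (subsetsOfSize≥ d (2 + c))
  familyAB = map both (subsetsOfSize≥ (d + d) (1 + c))
  template = familyA ++ familyB ++ familyAB

  data Member : Subset (2 + (d + d)) → Set where
    onlyA∈ : ∀ {y} → 2 + c ≤ ∣ y ∣ → Member (onlyA y)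
    onlyB∈ : ∀ {z} → 2 + c ≤ ∣ z ∣ → Member (onlyB z)
    both∈ : ∀ {w} → 1 + c ≤ ∣ w ∣ → Member (both w)

  member : ∀ {A} → A ∈ template → Member A
  member A∈ with ∈-++⁻ familyA A∈
  ... | inj₁ A∈ᵃ with ∈-map⁻ onlyA A∈ᵃ
  ...   | y , y∈ , refl = onlyA∈ (∈-subsetsOfSize≥⁻ y∈)
  member A∈ | inj₂ A∈′ with ∈-++⁻ familyB A∈′
  ... | inj₁ A∈ᵇ with ∈-map⁻ onlyB A∈ᵇ
  ...   | z , z∈ , refl = onlyB∈ (∈-subsetsOfSize≥⁻ z∈)
  member A∈ | inj₂ A∈′ | inj₂ A∈ᵃᵇ with ∈-map⁻ both A∈ᵃᵇ
  ...   | w , w∈ , refl = both∈ (∈-subsetsOfSize≥⁻ w∈)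

  onlyA∈template : ∀ {y} → 2 + c ≤ ∣ y ∣ → onlyA y ∈ template
  onlyA∈template h = ∈-++⁺ˡ (∈-map⁺ onlyA (∈-subsetsOfSize≥⁺ h))

  onlyB∈template : ∀ {z} → 2 + c ≤ ∣ z ∣ → onlyB z ∈ template
  onlyB∈template h = ∈-++⁺ʳ familyA (∈-++⁺ˡ (∈-map⁺ onlyB (∈-subsetsOfSize≥⁺ h)))

  both∈template : ∀ {w} → 1 + c ≤ ∣ w ∣ → both w ∈ template
  both∈template h = ∈-++⁺ʳ familyA (∈-++⁺ʳ familyB (∈-map⁺ both (∈-subsetsOfSize≥⁺ h)))

  ∣y++⊥∣ : ∀ (y : Subset d) → ∣ y ++ᵛ ⊥ {d} ∣ ≡ ∣ y ∣
  ∣y++⊥∣ y = trans (∣p++q∣ y ⊥) (trans (cong (∣ y ∣ +_) (∣⊥∣≡0 d)) (+-identityʳ _))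

  ∣⊥++z∣ : ∀ (z : Subset d) → ∣ ⊥ {d} ++ᵛ z ∣ ≡ ∣ z ∣
  ∣⊥++z∣ z = trans (∣p++q∣ (⊥ {d}) z) (cong (_+ ∣ z ∣) (∣⊥∣≡0 d))

  rest : ∀ {A} → Member A → Subset (d + d)
  rest (onlyA∈ {y} _) = y ++ᵛ ⊥ {d}
  rest (onlyB∈ {z} _) = ⊥ {d} ++ᵛ z
  rest (both∈ {w} _) = w

  1+c≤∣rest∣ : ∀ {A} (M : Member A) → 1 + c ≤ ∣ rest M ∣
  1+c≤∣rest∣ (onlyA∈ {y} h) = subst (1 + c ≤_) (sym (∣y++⊥∣ y)) (≤-trans (n≤1+n _) h)
  1+c≤∣rest∣ (onlyB∈ {z} h) = subst (1 + c ≤_) (sym (∣⊥++z∣ z)) (≤-trans (n≤1+n _) h)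
  1+c≤∣rest∣ (both∈ h) = h

  3+c≤∣member∣ : ∀ {A} → Member A → 3 + c ≤ ∣ A ∣
  3+c≤∣member∣ (onlyA∈ {y} h) = s≤s (subst (2 + c ≤_) (sym (∣y++⊥∣ y)) h)
  3+c≤∣member∣ (onlyB∈ {z} h) = s≤s (subst (2 + c ≤_) (sym (∣⊥++z∣ z)) h)
  3+c≤∣member∣ (both∈ h) = s≤s (s≤s h)

  template-unionClosed : UnionClosed template
  template-unionClosed A B A∈ B∈ = ∪∈ (member A∈) (member B∈)
    where
    viaBoth : ∀ {A B} (MA : Member A) (MB : Member B) → both (rest MA ∪ rest MB) ∈ template
    viaBoth MA MB = both∈template (≤-trans (1+c≤∣rest∣ MA) (∣p∣≤∣p∪q∣ (rest MA) (rest MB)))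
    ∪∈ : ∀ {A B} → Member A → Member B → (A ∪ B) ∈ template
    ∪∈ (onlyA∈ {y} h) (onlyA∈ {y′} _) =
      subst (_∈ template) (cong (λ v → true ∷ false ∷ v)
        (sym (trans (zipWith-++ _ y (⊥ {d}) y′ ⊥) (cong ((y ∪ y′) ++ᵛ_) (∪-idem ⊥)))))
        (onlyA∈template (≤-trans h (∣p∣≤∣p∪q∣ y y′)))
    ∪∈ (onlyB∈ {z} h) (onlyB∈ {z′} _) =
      subst (_∈ template) (cong (λ v → false ∷ true ∷ v)
        (sym (trans (zipWith-++ _ (⊥ {d}) z ⊥ z′) (cong (_++ᵛ (z ∪ z′)) (∪-idem ⊥)))))
        (onlyB∈template (≤-trans h (∣p∣≤∣p∪q∣ z z′)))
    ∪∈ MA@(onlyA∈ _) MB@(onlyB∈ _) = viaBoth MA MB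
    ∪∈ MA@(onlyA∈ _) MB@(both∈ _) = viaBoth MA MB
    ∪∈ MA@(onlyB∈ _) MB@(onlyA∈ _) = viaBoth MA MB
    ∪∈ MA@(onlyB∈ _) MB@(both∈ _) = viaBoth MA MB
    ∪∈ MA@(both∈ _) MB@(onlyA∈ _) = viaBoth MA MB
    ∪∈ MA@(both∈ _) MB@(onlyB∈ _) = viaBoth MA MB
    ∪∈ MA@(both∈ _) MB@(both∈ _) = viaBoth MA MB

  template-distinct : Distinct template
  template-distinct = Unique.++⁺ (Unique.map⁺ onlyA-injective (subsetsOfSize≥-distinct d (2 + c)))
    (Unique.++⁺ (Unique.map⁺ onlyB-injective (subsetsOfSize≥-distinct d (2 + c)))
                (Unique.map⁺ (∷-injectiveʳ ∘ ∷-injectiveʳ) (subsetsOfSize≥-distinct (d + d) (1 + c)))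
                B∩AB≡∅)
    A∩[B∪AB]≡∅
    where
    onlyA-injective : ∀ {y y′} → onlyA y ≡ onlyA y′ → y ≡ y′
    onlyA-injective = ++-injectiveˡ _ _ ∘ ∷-injectiveʳ ∘ ∷-injectiveʳ
    onlyB-injective : ∀ {z z′} → onlyB z ≡ onlyB z′ → z ≡ z′
    onlyB-injective = ++-injectiveʳ (⊥ {d}) ⊥ ∘ ∷-injectiveʳ ∘ ∷-injectiveʳ
    B∩AB≡∅ : ∀ {A} → ¬ (A ∈ familyB × A ∈ familyAB)
    B∩AB≡∅ (A∈ᵇ , A∈ᵃᵇ) with ∈-map⁻ onlyB A∈ᵇ | ∈-map⁻ both A∈ᵃᵇ
    ... | _ , _ , refl | _ , _ , ()
    A∩[B∪AB]≡∅ : ∀ {A} → ¬ (A ∈ familyA × A ∈ (familyB ++ familyAB))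
    A∩[B∪AB]≡∅ (A∈ᵃ , A∈′) with ∈-map⁻ onlyA A∈ᵃ | ∈-++⁻ familyB A∈′
    ... | _ , _ , refl | inj₁ A∈ᵇ with ∈-map⁻ onlyB A∈ᵇ
    ...   | _ , _ , ()
    A∩[B∪AB]≡∅ (A∈ᵃ , A∈′) | _ , _ , refl | inj₂ A∈ᵃᵇ with ∈-map⁻ both A∈ᵃᵇ
    ...   | _ , _ , ()

  length-template : length template ≡ atLeast d (2 + c) + (atLeast d (2 + c) + atLeast (d + d) (1 + c))
  length-template = trans (length-++ familyA) (cong₂ _+_ (len onlyA) (trans (length-++ familyB) (cong₂ _+_ (len onlyB) (len both))))
    where
    len : ∀ {n j} (f : Subset n → Subset (2 + (d + d))) → length (map f (subsetsOfSize≥ n j)) ≡ atLeast n j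
    len {n} {j} f = trans (length-map f (subsetsOfSize≥ n j)) (length-subsetsOfSize≥ n j)

  deg-template : ∀ x → deg template x ≡ deg familyA x + (deg familyB x + deg familyAB x)
  deg-template x = trans (count-++ _ familyA _) (cong (deg familyA x +_) (count-++ _ familyB _))

  deg-rest : ∀ q → deg template (suc (suc q)) ≡ atLeast e (1 + c) + atLeast (e + d) c
  deg-rest q = begin
    deg template x
      ≡⟨ deg-template x ⟩
    deg familyA x + (deg familyB x + deg familyAB x)
      ≡⟨ +-assoc (deg familyA x) _ _ ⟨
    deg familyA x + deg familyB x + deg familyAB x
      ≡⟨ cong₂ _+_ oneSided (trans (deg-subsetsOfSize≥ both x) (atLeast-∋ (e + d) q c)) ⟩
    atLeast e (1 + c) + atLeast (e + d) c ∎
    where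
    open ≡-Reasoning
    x = suc (suc q)
    inY : ∀ (y : Subset d) → lookup (onlyA y) x ≡ [ lookup y , lookup (⊥ {d}) ]′ (splitAt d q)
    inY y = lookup-splitAt d y ⊥ q
    inZ : ∀ (z : Subset d) → lookup (onlyB z) x ≡ [ lookup (⊥ {d}) , lookup z ]′ (splitAt d q)
    inZ z = lookup-splitAt d ⊥ z q
    -- q lies in Y or in Z; exactly one of the one-sided families can contain it.
    oneSided : deg familyA x + deg familyB x ≡ atLeast e (1 + c)
    oneSided with splitAt d q in eq
    ... | inj₁ i = trans (cong₂ _+_
      (trans (deg-subsetsOfSize≥ onlyA x)
             (trans (count-cong (subsets d) (λ y → cong (_ ∧_) (trans (inY y) (cong [ lookup y , lookup ⊥ ]′ eq))))
                    (atLeast-∋ e i (1 + c))))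
      (deg-none onlyB x (λ z → trans (inZ z) (trans (cong [ lookup ⊥ , lookup z ]′ eq) (lookup-replicate i false)))))
      (+-identityʳ _)
    ... | inj₂ j = cong₂ _+_
      (deg-none onlyA x (λ y → trans (inY y) (trans (cong [ lookup y , lookup ⊥ ]′ eq) (lookup-replicate j false))))
      (trans (deg-subsetsOfSize≥ onlyB x)
             (trans (count-cong (subsets d) (λ z → cong (_ ∧_) (trans (inZ z) (cong [ lookup ⊥ , lookup z ]′ eq))))
                    (atLeast-∋ e j (1 + c))))

  module _ (2+c≤d : 2 + c ≤ d) where

    1+c≤e : 1 + c ≤ e
    1+c≤e = ≤-pred 2+c≤d

    1+c≤d+d : 1 + c ≤ d + d
    1+c≤d+d = ≤-trans (n≤1+n _) (≤-trans 2+c≤d (m≤m+n d d))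

    template-minSize : MinSize template (3 + c)
    template-minSize = both w₀ , (both∈template (≤-reflexive (sym ∣w₀∣)) , cong (2 +_) ∣w₀∣) ,
                       λ B B∈ → 3+c≤∣member∣ (member B∈)
      where
      w₀ = initialSegment (d + d) (1 + c) 1+c≤d+d
      ∣w₀∣ = ∣initialSegment∣ (d + d) (1 + c) 1+c≤d+d

    template-maxSize : MaxSize template (2 + (d + d))
    template-maxSize = both ⊤ , (both∈template (subst (1 + c ≤_) (sym (∣⊤∣≡n (d + d))) 1+c≤d+d) ,
                                 cong (2 +_) (∣⊤∣≡n (d + d))) ,
                       λ B _ → ∣p∣≤n B

    both∁⁅q⁆∈template : ∀ q → both (∁ ⁅ q ⁆) ∈ template
    both∁⁅q⁆∈template q = both∈template (subst (1 + c ≤_) (sym ∣∁⁅q⁆∣) (≤-trans 1+c≤e (m≤m+n e d)))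
      where
      ∣∁⁅q⁆∣ : ∣ ∁ ⁅ q ⁆ ∣ ≡ e + d
      ∣∁⁅q⁆∣ = trans (∣∁p∣≡n∸∣p∣ ⁅ q ⁆) (cong (d + d ∸_) (∣⁅x⁆∣≡1 q))

    ∈both∁⁅q⁆ : ∀ {x} q → x ≢ suc (suc q) → x ∈ₛ both (∁ ⁅ q ⁆)
    ∈both∁⁅q⁆ {zero} q _ = here
    ∈both∁⁅q⁆ {suc zero} q _ = there here
    ∈both∁⁅q⁆ {suc (suc x)} q x≢q = there (there (x∉p⇒x∈∁p (λ x∈⁅q⁆ → x≢q (cong (λ i → suc (suc i)) (x∈⁅y⁆⇒x≡y q x∈⁅q⁆)))))

    ∉both∁⁅q⁆ : ∀ q → ¬ (suc (suc q) ∈ₛ both (∁ ⁅ q ⁆))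
    ∉both∁⁅q⁆ q (there (there q∈∁⁅q⁆)) = x∈p⇒x∉∁p (x∈⁅x⁆ q) q∈∁⁅q⁆

    template-twinFree : TwinFree template
    template-twinFree x (suc (suc q)) _ _ tw = separatedFromRest q tw
      where
      separatedFromRest : ∀ {x} q → ¬ Twins template x (suc (suc q))
      separatedFromRest q tw@(x≢q , _) = separated⇒¬Twins (both∁⁅q⁆∈template q) (∈both∁⁅q⁆ q x≢q) (∉both∁⁅q⁆ q) tw
    template-twinFree (suc (suc q)) y y∈ q∈ tw = template-twinFree y (suc (suc q)) q∈ y∈ (Twins-sym tw)
    template-twinFree zero zero _ _ (0≢0 , _) = 0≢0 refl
    template-twinFree (suc zero) (suc zero) _ _ (1≢1 , _) = 1≢1 refl
    template-twinFree zero (suc zero) _ _ = a≁b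
      where
      a≁b : ¬ Twins template zero (suc zero)
      a≁b = separated⇒¬Twins (onlyA∈template {⊤} (subst (2 + c ≤_) (sym (∣⊤∣≡n d)) 2+c≤d)) here (λ { (there ()) })
    template-twinFree (suc zero) zero b∈ a∈ = template-twinFree zero (suc zero) a∈ b∈ ∘ Twins-sym

    majority-a : majority (length template) (deg template zero) ≡ true
    majority-a = begin
      majority (length template) (deg template zero)
        ≡⟨ cong₂ majority length-template (trans (deg-template zero)
             (cong₂ _+_ (deg-all onlyA zero (λ _ → refl)) (cong₂ _+_ (deg-none onlyB zero (λ _ → refl)) (deg-all both zero (λ _ → refl))))) ⟩
      majority (atLeast d (2 + c) + (atLeast d (2 + c) + atLeast (d + d) (1 + c))) (atLeast d (2 + c) + atLeast (d + d) (1 + c))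
        ≡⟨ majority-A+W (atLeast d (2 + c)) (atLeast (d + d) (1 + c)) (atLeast-pos 1+c≤d+d) ⟩
      true ∎
      where open ≡-Reasoning

    majority-b : majority (length template) (deg template (suc zero)) ≡ true
    majority-b = begin
      majority (length template) (deg template (suc zero))
        ≡⟨ cong₂ majority length-template (trans (deg-template (suc zero))
             (cong₂ _+_ (deg-none onlyA (suc zero) (λ _ → refl)) (cong₂ _+_ (deg-all onlyB (suc zero) (λ _ → refl)) (deg-all both (suc zero) (λ _ → refl))))) ⟩
      majority (atLeast d (2 + c) + (atLeast d (2 + c) + atLeast (d + d) (1 + c))) (atLeast d (2 + c) + atLeast (d + d) (1 + c))
        ≡⟨ majority-A+W (atLeast d (2 + c)) (atLeast (d + d) (1 + c)) (atLeast-pos 1+c≤d+d) ⟩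
      true ∎
      where open ≡-Reasoning

    module _ (balanced : choose (e + d) c ≤ 2 * atLeast e (2 + c)) where

      -- Expanding every count by Pascal's rule, 2 · deg ≤ length reduces to the hypothesis.
      majority-rest : ∀ q → majority (length template) (deg template (suc (suc q))) ≡ false
      majority-rest q = trans (cong₂ majority length-template (deg-rest q)) (majority-false (g + atLeast (e + d) c) (subst₂ (λ L D → 2 * D ≤ L) (sym L≡) (sym D≡) arith))
        where
        a′ = atLeast e (2 + c)
        g = atLeast e (1 + c)
        w = atLeast (e + d) (1 + c)
        ch = choose (e + d) c
        C≡ : atLeast (e + d) c ≡ ch + w
        C≡ = atLeast-choose (e + d) c
        L≡ : atLeast d (2 + c) + (atLeast d (2 + c) + atLeast (d + d) (1 + c)) ≡ (a′ + g) + ((a′ + g) + (w + (ch + w)))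
        L≡ = cong₂ _+_ (atLeast-suc e (1 + c)) (cong₂ _+_ (atLeast-suc e (1 + c)) (trans (atLeast-suc (e + d) c) (cong (w +_) C≡)))
        D≡ : g + atLeast (e + d) c ≡ g + (ch + w)
        D≡ = cong (g +_) C≡
        arith : 2 * (g + (ch + w)) ≤ (a′ + g) + ((a′ + g) + (w + (ch + w)))
        arith = subst₂ _≤_
          (solve 4 (λ a′ g w ch → (con 2 :* g :+ con 2 :* w :+ ch) :+ ch := con 2 :* (g :+ (ch :+ w))) refl a′ g w ch)
          (solve 4 (λ a′ g w ch → (con 2 :* g :+ con 2 :* w :+ ch) :+ con 2 :* a′ := (a′ :+ g) :+ ((a′ :+ g) :+ (w :+ (ch :+ w)))) refl a′ g w ch)
          (+-monoʳ-≤ (2 * g + 2 * w + ch) balanced)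
          where open +-*-Solver

      template-majority : ∀ x → majority (length template) (deg template x) ≡ lookup (both ⊥) x
      template-majority zero = majority-a
      template-majority (suc zero) = majority-b
      template-majority (suc (suc q)) = trans (majority-rest q) (sym (lookup-replicate q false))

      template-frequentCount : frequentCount template ≡ 2
      template-frequentCount = begin
        frequentCount template                                        ≡⟨ frequentCount≡countFin template ⟩
        countFin _ (λ x → majority (length template) (deg template x)) ≡⟨ countFin-cong _ template-majority ⟩
        countFin _ (lookup (both ⊥))                                  ≡⟨ ∣p∣≡countFin (both ⊥) ⟨
        2 + ∣ ⊥ {d + d} ∣                                             ≡⟨ cong (2 +_) (∣⊥∣≡0 (d + d)) ⟩
        2 ∎
        where open ≡-Reasoning

      template-construction : TwinFreeConstruction 2 (3 + c) (2 + (d + d))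
      template-construction = 2 + (d + d) , template ,
        (template-distinct , template-unionClosed , template-frequentCount , template-minSize , template-maxSize) ,
        template-twinFree

-- The inequality of part 2

-- Ineq k n with ⌊n/2⌋ abstracted to h.
IneqAt : ℕ → ℕ → ℕ → Set
IneqAt k n h = (n ∸ 3) C (k ∸ 3) + (h ∸ 2) C (k ∸ 2) < sumFromTo (k ∸ 1) (h ∸ 1) ((h ∸ 1) C_)

IneqAt-small : ∀ c n h → h ≤ 1 → ¬ IneqAt (3 + c) n h
IneqAt-small c n h h≤1 ineq = n≮0 (subst ((n ∸ 3) C c + (h ∸ 2) C (1 + c) <_) sum≡0 ineq)
  where
  sum≡0 : sumFromTo (2 + c) (h ∸ 1) ((h ∸ 1) C_) ≡ 0
  sum≡0 = trans (sumFromTo-C≡atLeast (2 + c) (h ∸ 1)) (atLeast-zero (s≤s (≤-trans (∸-monoˡ-≤ 1 h≤1) z≤n)))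

-- By Pascal's rule the sum over i ≥ k - 1 of C(e + 1, i) is 2 · atLeast e (k - 1) + C(e, k - 2),
-- and the term C(e, k - 2) also occurs on the left.
IneqAt⇔ : ∀ c n e → IneqAt (3 + c) n (2 + e) ⇔ choose (n ∸ 3) c < 2 * atLeast e (2 + c)
IneqAt⇔ c n e = mk⇔
  (λ ineq → subst (X <_) a+a≡2a (+-cancelˡ-< Y X (a + a) (subst₂ _<_ lhs≡ sum≡ ineq)))
  (λ X<2a → subst₂ _<_ (sym lhs≡) (sym sum≡) (+-monoʳ-< Y (subst (X <_) (sym a+a≡2a) X<2a)))
  where
  X = choose (n ∸ 3) c
  Y = choose e (1 + c)
  a = atLeast e (2 + c)
  a+a≡2a : a + a ≡ 2 * a
  a+a≡2a = cong (a +_) (sym (+-identityʳ a))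
  lhs≡ : (n ∸ 3) C c + e C (1 + c) ≡ Y + X
  lhs≡ = trans (+-comm ((n ∸ 3) C c) (e C (1 + c))) (sym (cong₂ _+_ (choose≡C e (1 + c)) (choose≡C (n ∸ 3) c)))
  sum≡ : sumFromTo (2 + c) (1 + e) ((1 + e) C_) ≡ Y + (a + a)
  sum≡ = begin
    sumFromTo (2 + c) (1 + e) ((1 + e) C_)   ≡⟨ sumFromTo-C≡atLeast (2 + c) (1 + e) ⟩
    atLeast (1 + e) (2 + c)                  ≡⟨ atLeast-suc e (1 + c) ⟩
    a + atLeast e (1 + c)                    ≡⟨ cong (a +_) (atLeast-choose e (1 + c)) ⟩
    a + (Y + a)                              ≡⟨ solve 2 (λ a Y → a :+ (Y :+ a) := Y :+ (a :+ a)) refl a Y ⟩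
    Y + (a + a) ∎
    where
    open ≡-Reasoning
    open +-*-Solver

template-TwinFreeConstruction : ∀ c e → choose (e + suc e) c < 2 * atLeast e (2 + c) →
                                TwinFreeConstruction 2 (3 + c) ((2 + e) + (2 + e))
template-TwinFreeConstruction c e X<2a =
  subst (TwinFreeConstruction 2 (3 + c)) (cong (2 +_) (sym (+-suc e (suc e))))
        (Template.template-construction c e 2+c≤d (<⇒≤ X<2a))
  where
  0<a : 0 < atLeast e (2 + c)
  0<a = *-cancelˡ-< 2 0 (atLeast e (2 + c)) (≤-<-trans z≤n X<2a)
  2+c≤d : 2 + c ≤ suc e
  2+c≤d = m≤n⇒m≤1+n (atLeast-pos⁻ 0<a)

Ineq⇒TwinFreeConstruction : ∀ k n → 3 ≤ k → Ineq k n → TwinFreeConstruction 2 k n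
Ineq⇒TwinFreeConstruction 0 n () _
Ineq⇒TwinFreeConstruction 1 n (s≤s ()) _
Ineq⇒TwinFreeConstruction 2 n (s≤s (s≤s ())) _
Ineq⇒TwinFreeConstruction (suc (suc (suc c))) n _ ineq with halves n
... | even h = fromHalf h (subst (IneqAt (3 + c) (h + h)) (half-even h) ineq)
  where
  fromHalf : ∀ h → IneqAt (3 + c) (h + h) h → TwinFreeConstruction 2 (3 + c) (h + h)
  fromHalf zero ineq = contradiction ineq (IneqAt-small c 0 0 z≤n)
  fromHalf (suc zero) ineq = contradiction ineq (IneqAt-small c 2 1 (s≤s z≤n))
  fromHalf (suc (suc e)) ineq = template-TwinFreeConstruction c e
    (subst (λ m → choose m c < 2 * atLeast e (2 + c)) (cong (_∸ 1) (+-suc e (suc e))) (Equivalence.to (IneqAt⇔ c (suc (suc e) + suc (suc e)) e) ineq))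
... | odd h = fromHalf h (subst (IneqAt (3 + c) (suc (h + h))) (half-odd h) ineq)
  where
  fromHalf : ∀ h → IneqAt (3 + c) (suc (h + h)) h → TwinFreeConstruction 2 (3 + c) (suc (h + h))
  fromHalf zero ineq = contradiction ineq (IneqAt-small c 1 0 z≤n)
  fromHalf (suc zero) ineq = contradiction ineq (IneqAt-small c 3 1 (s≤s z≤n))
  fromHalf (suc (suc e)) ineq = TwinFreeConstruction-suc (template-TwinFreeConstruction c e
    (≤-<-trans (choose-mono-suc (e + suc e) c)
      (subst (λ m → choose m c < 2 * atLeast e (2 + c)) (+-suc e (suc e)) (Equivalence.to (IneqAt⇔ c (suc (suc (suc e) + suc (suc e))) e) ineq))))

-- Writing U = k - 1 = c + 2 and K = 4U: a binomial of degree c in t ≤ K x is at most K^c x^c ≤ x^(c+1),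
-- while the count of U-subsets of an (Ux)-set is at least x^U = x^(c+2).
choose<2*atLeast : ∀ c x e t → 1 ≤ x → (4 * (2 + c)) ^ c ≤ x → t ≤ 4 * (2 + c) * x → (2 + c) * x ≤ e →
                   choose t c < 2 * atLeast e (2 + c)
choose<2*atLeast c x e t 1≤x K^c≤x t≤Kx Ux≤e = ≤-<-trans choose≤x^U (subst (x ^ U <_) (sym 2*atLeast≡) x^U<2z)
  where
  U = 2 + c
  K = 4 * U
  z = atLeast e U
  2*atLeast≡ : 2 * z ≡ z + z
  2*atLeast≡ = cong (z +_) (+-identityʳ z)
  x^U≤z : x ^ U ≤ z
  x^U≤z = ≤-trans (^≤choose U x) (≤-trans (choose-monoˡ U Ux≤e) (choose≤atLeast e U))
  x^U<2z : x ^ U < z + z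
  x^U<2z = <-≤-trans (m<m+n (x ^ U) (≤-trans (1≤^ U 1≤x) x^U≤z)) (+-monoˡ-≤ z x^U≤z)
  choose≤x^U : choose t c ≤ x ^ U
  choose≤x^U = begin
    choose t c        ≤⟨ choose≤^ t c ⟩
    t ^ c             ≤⟨ ^-monoˡ-≤ c t≤Kx ⟩
    (K * x) ^ c       ≡⟨ ^-distribʳ-* K x c ⟩
    K ^ c * x ^ c     ≤⟨ *-monoˡ-≤ (x ^ c) K^c≤x ⟩
    x * x ^ c         ≤⟨ *-monoʳ-≤ x (≤-trans (≤-reflexive (sym (*-identityˡ (x ^ c)))) (*-monoˡ-≤ (x ^ c) 1≤x)) ⟩
    x * (x * x ^ c) ∎
    where open ≤-Reasoning

Ineq-largeHalf : ∀ c n e → n / 2 ≡ 2 + e → n ∸ 3 ≤ suc e + suc e → (4 * (2 + c)) ^ c * (2 + c) ≤ e → Ineq (3 + c) n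
Ineq-largeHalf c n e half≡ t≤ E₀≤e =
  subst (IneqAt (3 + c) n) (sym half≡)
        (Equivalence.from (IneqAt⇔ c n e) (choose<2*atLeast c x e (n ∸ 3) 1≤x K^c≤x t≤Kx Ux≤e))
  where
  U = 2 + c
  K = 4 * U
  x = e / U
  K^c≤x : K ^ c ≤ x
  K^c≤x = subst (_≤ x) (m*n/n≡m (K ^ c) U) (/-monoˡ-≤ U E₀≤e)
  1≤x : 1 ≤ x
  1≤x = ≤-trans (1≤^ c (s≤s z≤n)) K^c≤x
  Ux≤e : U * x ≤ e
  Ux≤e = subst (_≤ e) (*-comm x U) (m/n*n≤m e U)
  1+e≤[1+x]U : suc e ≤ suc x * U
  1+e≤[1+x]U = subst (λ m → suc m ≤ suc x * U) (sym (m≡m%n+[m/n]*n e U)) (+-monoˡ-≤ (x * U) (m%n<n e U))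
  t≤Kx : n ∸ 3 ≤ K * x
  t≤Kx = begin
    n ∸ 3                         ≤⟨ t≤ ⟩
    suc e + suc e                 ≤⟨ +-mono-≤ 1+e≤[1+x]U 1+e≤[1+x]U ⟩
    suc x * U + suc x * U         ≤⟨ +-mono-≤ (*-monoˡ-≤ U (+-monoˡ-≤ x 1≤x)) (*-monoˡ-≤ U (+-monoˡ-≤ x 1≤x)) ⟩
    (x + x) * U + (x + x) * U     ≡⟨ solve 2 (λ x U → (x :+ x) :* U :+ (x :+ x) :* U := (con 4 :* U) :* x) refl x U ⟩
    K * x ∎
    where
    open ≤-Reasoning
    open +-*-Solver

Ineq-eventually : ∀ k → 3 ≤ k → ∃[ N ] (∀ n → N ≤ n → Ineq k n)
Ineq-eventually 0 ()
Ineq-eventually 1 (s≤s ())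
Ineq-eventually 2 (s≤s (s≤s ()))
Ineq-eventually (suc (suc (suc c))) _ = (2 + E₀) + (2 + E₀) , λ n N≤n → fromHalves n N≤n (halves n)
  where
  E₀ = (4 * (2 + c)) ^ c * (2 + c)
  fromHalf : ∀ n h → n / 2 ≡ h → n ≤ suc (h + h) → 2 + E₀ ≤ h → Ineq (3 + c) n
  fromHalf n (suc (suc e)) half≡ n≤ (s≤s (s≤s E₀≤e)) =
    Ineq-largeHalf c n e half≡ (≤-trans (∸-monoˡ-≤ 3 n≤) (≤-reflexive (+-suc e (suc e)))) E₀≤e
  fromHalves : ∀ n → (2 + E₀) + (2 + E₀) ≤ n → Halves n → Ineq (3 + c) n
  fromHalves _ N≤n (even h) = fromHalf (h + h) h (half-even h) (n≤1+n _) (double-≤ _ h (≤-trans N≤n (n≤1+n _)))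
  fromHalves _ N≤n (odd h) = fromHalf (suc (h + h)) h (half-odd h) ≤-refl (double-≤ _ h N≤n)

weight-replicate : ∀ n v (p : Fin n → Bool) → weight (replicate n v) p ≡ countFin n p * suc v
weight-replicate zero v p = refl
weight-replicate (suc n) v p = trans (cong (bit (p zero) * suc v +_) (weight-replicate n v (p ∘ suc)))
                                     (sym (*-distribʳ-+ (suc v) (bit (p zero)) _))

total-replicate : ∀ n v → total (replicate n v) ≡ n * suc v
total-replicate zero v = refl
total-replicate (suc n) v = cong (λ m → suc (v + m)) (total-replicate n v)

weight-⊥ : ∀ {m} (ω : Vec ℕ m) → weight ω (lookup ⊥) ≡ 0
weight-⊥ [] = refl
weight-⊥ (w ∷ ω) = weight-⊥ ω

-- In the template with k = 4 and |Y| = |Z| = 5, a and b get weight 1 and the ten elements of Y ∪ Z the weights 1 + ωY.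
module WeightedTemplate (ωY : Vec ℕ 10) where

  open Template 1 4

  ω : Vec ℕ 12
  ω = 0 ∷ 0 ∷ ωY

  3≤5 : 3 ≤ 5
  3≤5 = s≤s (s≤s (s≤s z≤n))

  balanced : choose 9 1 ≤ 2 * atLeast 4 3
  balanced = from-yes (choose 9 1 ≤? 2 * atLeast 4 3)

  weightedTemplate-frequentCount : frequentCount (map (blowUp ω) template) ≡ 2
  weightedTemplate-frequentCount = begin
    frequentCount (map (blowUp ω) template)
      ≡⟨ blowUp-frequentCount ω template ⟩
    weight ω (λ x → majority (length template) (deg template x))
      ≡⟨ weight-cong ω (template-majority 3≤5 balanced) ⟩
    weight ω (lookup (both ⊥))
      ≡⟨ cong (2 +_) (weight-⊥ ωY) ⟩
    2 ∎
    where open ≡-Reasoning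

  weightedTemplate-construction : ∀ {k} → (∀ {A} → Member A → k ≤ weight ω (lookup A)) →
    (∃[ w ] (2 ≤ ∣ w ∣ × 2 + weight ωY (lookup w) ≡ k)) → Construction 2 k (total ω)
  weightedTemplate-construction bound (w , 2≤∣w∣ , weight≡k) =
    total ω , map (blowUp ω) template , blowUp-distinct ω template template-distinct , blowUp-unionClosed ω template template-unionClosed ,
    weightedTemplate-frequentCount ,
    blowUp-minSize ω template (both w , both∈template 2≤∣w∣ , weight≡k) (λ A A∈ → bound (member A∈)) ,
    blowUp-maxSize ω template (both∈template (s≤s (s≤s z≤n)))

  boundFromRest : ∀ {k} → (∀ t → 3 ≤ ∣ t ∣ → k ≤ 1 + weight ωY (lookup t)) → (∀ t → 2 ≤ ∣ t ∣ → k ≤ 2 + weight ωY (lookup t)) →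
                  ∀ {A} → Member A → k ≤ weight ω (lookup A)
  boundFromRest oneSided _ (onlyA∈ {y} h) = oneSided (y ++ᵛ ⊥ {5}) (subst (3 ≤_) (sym (∣y++⊥∣ y)) h)
  boundFromRest oneSided _ (onlyB∈ {z} h) = oneSided (⊥ {5} ++ᵛ z) (subst (3 ≤_) (sym (∣⊥++z∣ z)) h)
  boundFromRest _ twoSided (both∈ {w} h) = twoSided w h

weight-uniform : ∀ {n} v (t : Subset n) → weight (replicate n v) (lookup t) ≡ ∣ t ∣ * suc v
weight-uniform {n} v t = trans (weight-replicate n v (lookup t)) (cong (_* suc v) (sym (∣p∣≡countFin t)))

firstTwo : Subset 10
firstTwo = true ∷ true ∷ ⊥

construction-even : ∀ v → Construction 2 (4 + (v + v)) (2 + 10 * suc v)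
construction-even v = subst (Construction 2 (4 + (v + v))) (cong (2 +_) (total-replicate 10 v))
  (weightedTemplate-construction (boundFromRest oneSided twoSided) (firstTwo , s≤s (s≤s z≤n) , witness))
  where
  open WeightedTemplate (replicate 10 v)
  open +-*-Solver
  oneSided : ∀ t → 3 ≤ ∣ t ∣ → 4 + (v + v) ≤ 1 + weight (replicate 10 v) (lookup t)
  oneSided t 3≤∣t∣ = begin
    4 + (v + v)         ≤⟨ m≤m+n (4 + (v + v)) v ⟩
    4 + (v + v) + v     ≡⟨ solve 1 (λ v → con 4 :+ (v :+ v) :+ v := con 1 :+ con 3 :* (con 1 :+ v)) refl v ⟩
    1 + 3 * suc v       ≤⟨ s≤s (*-monoˡ-≤ (suc v) 3≤∣t∣) ⟩
    1 + ∣ t ∣ * suc v   ≡⟨ cong suc (weight-uniform v t) ⟨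
    1 + weight (replicate 10 v) (lookup t) ∎
    where open ≤-Reasoning
  twoSided : ∀ t → 2 ≤ ∣ t ∣ → 4 + (v + v) ≤ 2 + weight (replicate 10 v) (lookup t)
  twoSided t 2≤∣t∣ = begin
    4 + (v + v)         ≡⟨ solve 1 (λ v → con 4 :+ (v :+ v) := con 2 :+ con 2 :* (con 1 :+ v)) refl v ⟩
    2 + 2 * suc v       ≤⟨ +-monoʳ-≤ 2 (*-monoˡ-≤ (suc v) 2≤∣t∣) ⟩
    2 + ∣ t ∣ * suc v   ≡⟨ cong (2 +_) (weight-uniform v t) ⟨
    2 + weight (replicate 10 v) (lookup t) ∎
    where open ≤-Reasoning
  witness : 2 + weight (replicate 10 v) (lookup firstTwo) ≡ 4 + (v + v)
  witness = trans (cong (2 +_) (weight-uniform v firstTwo))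
                  (solve 1 (λ v → con 2 :+ con 2 :* (con 1 :+ v) := con 4 :+ (v :+ v)) refl v)

-- For odd k one element of Y gets one copy less than the others.
oddWeights : ℕ → Vec ℕ 10
oddWeights v = v ∷ replicate 9 (suc v)

weight-oddWeights : ∀ v (t : Subset 10) → ∣ t ∣ * (2 + v) ≤ suc (weight (oddWeights v) (lookup t))
weight-oddWeights v (true ∷ t) = ≤-reflexive (begin
  suc ∣ t ∣ * (2 + v)                       ≡⟨ solve 2 (λ v s → (con 1 :+ s) :* (con 2 :+ v) := con 1 :+ (con 1 :* (con 1 :+ v) :+ s :* (con 2 :+ v))) refl v ∣ t ∣ ⟩
  suc (1 * suc v + ∣ t ∣ * (2 + v))         ≡⟨ cong (λ x → suc (1 * suc v + x)) (weight-uniform (suc v) t) ⟨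
  suc (weight (oddWeights v) (lookup (true ∷ t))) ∎)
  where
  open ≡-Reasoning
  open +-*-Solver
weight-oddWeights v (false ∷ t) = ≤-trans (≤-reflexive (sym (weight-uniform (suc v) t))) (n≤1+n _)

construction-odd : ∀ v → Construction 2 (5 + (v + v)) (3 + (v + 9 * (2 + v)))
construction-odd v = subst (Construction 2 (5 + (v + v))) (cong (λ m → 3 + (v + m)) (total-replicate 9 (suc v)))
  (weightedTemplate-construction (boundFromRest oneSided twoSided) (firstTwo , s≤s (s≤s z≤n) , witness))
  where
  open WeightedTemplate (oddWeights v)
  open +-*-Solver
  oneSided : ∀ t → 3 ≤ ∣ t ∣ → 5 + (v + v) ≤ 1 + weight (oddWeights v) (lookup t)
  oneSided t 3≤∣t∣ = ≤-trans (n≤1+n _) (≤-trans (begin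
    6 + (v + v)               ≤⟨ m≤m+n (6 + (v + v)) v ⟩
    6 + (v + v) + v           ≡⟨ solve 1 (λ v → con 6 :+ (v :+ v) :+ v := con 3 :* (con 2 :+ v)) refl v ⟩
    3 * (2 + v)               ≤⟨ *-monoˡ-≤ (2 + v) 3≤∣t∣ ⟩
    ∣ t ∣ * (2 + v) ∎) (weight-oddWeights v t))
    where open ≤-Reasoning
  twoSided : ∀ t → 2 ≤ ∣ t ∣ → 5 + (v + v) ≤ 2 + weight (oddWeights v) (lookup t)
  twoSided t 2≤∣t∣ = s≤s (begin
    4 + (v + v)               ≡⟨ solve 1 (λ v → con 4 :+ (v :+ v) := con 2 :* (con 2 :+ v)) refl v ⟩
    2 * (2 + v)               ≤⟨ *-monoˡ-≤ (2 + v) 2≤∣t∣ ⟩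
    ∣ t ∣ * (2 + v)           ≤⟨ weight-oddWeights v t ⟩
    suc (weight (oddWeights v) (lookup t)) ∎)
    where open ≤-Reasoning
  witness : 2 + weight (oddWeights v) (lookup firstTwo) ≡ 5 + (v + v)
  witness = trans (cong (λ x → 2 + (1 * suc v + x)) (weight-uniform (suc v) (true ∷ ⊥ {8})))
                  (solve 1 (λ v → con 2 :+ (con 1 :* (con 1 :+ v) :+ con 1 :* (con 2 :+ v)) := con 5 :+ (v :+ v)) refl v)

F-2-3-8 : Family 8
F-2-3-8 =
  (true ∷ true ∷ true ∷ false ∷ false ∷ false ∷ false ∷ false ∷ [])
  ∷ (true ∷ true ∷ false ∷ true ∷ false ∷ false ∷ false ∷ false ∷ [])
  ∷ (true ∷ false ∷ true ∷ true ∷ false ∷ false ∷ false ∷ false ∷ [])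
  ∷ (true ∷ true ∷ true ∷ true ∷ false ∷ false ∷ false ∷ false ∷ [])
  ∷ (true ∷ true ∷ false ∷ false ∷ true ∷ false ∷ false ∷ false ∷ [])
  ∷ (true ∷ false ∷ true ∷ false ∷ true ∷ false ∷ false ∷ false ∷ [])
  ∷ (true ∷ true ∷ true ∷ false ∷ true ∷ false ∷ false ∷ false ∷ [])
  ∷ (true ∷ false ∷ false ∷ true ∷ true ∷ false ∷ false ∷ false ∷ [])
  ∷ (true ∷ true ∷ false ∷ true ∷ true ∷ false ∷ false ∷ false ∷ [])
  ∷ (true ∷ false ∷ true ∷ true ∷ true ∷ false ∷ false ∷ false ∷ [])
  ∷ (true ∷ true ∷ true ∷ true ∷ true ∷ false ∷ false ∷ false ∷ [])
  ∷ (true ∷ true ∷ false ∷ false ∷ false ∷ true ∷ false ∷ false ∷ [])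
  ∷ (true ∷ true ∷ true ∷ false ∷ false ∷ true ∷ false ∷ false ∷ [])
  ∷ (true ∷ true ∷ false ∷ true ∷ false ∷ true ∷ false ∷ false ∷ [])
  ∷ (true ∷ true ∷ true ∷ true ∷ false ∷ true ∷ false ∷ false ∷ [])
  ∷ (true ∷ true ∷ false ∷ false ∷ true ∷ true ∷ false ∷ false ∷ [])
  ∷ (true ∷ true ∷ true ∷ false ∷ true ∷ true ∷ false ∷ false ∷ [])
  ∷ (true ∷ true ∷ false ∷ true ∷ true ∷ true ∷ false ∷ false ∷ [])
  ∷ (true ∷ true ∷ true ∷ true ∷ true ∷ true ∷ false ∷ false ∷ [])
  ∷ (true ∷ true ∷ false ∷ false ∷ false ∷ false ∷ true ∷ false ∷ [])
  ∷ (true ∷ true ∷ true ∷ false ∷ false ∷ false ∷ true ∷ false ∷ [])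
  ∷ (true ∷ true ∷ false ∷ true ∷ false ∷ false ∷ true ∷ false ∷ [])
  ∷ (true ∷ true ∷ true ∷ true ∷ false ∷ false ∷ true ∷ false ∷ [])
  ∷ (true ∷ true ∷ false ∷ false ∷ true ∷ false ∷ true ∷ false ∷ [])
  ∷ (true ∷ true ∷ true ∷ false ∷ true ∷ false ∷ true ∷ false ∷ [])
  ∷ (true ∷ true ∷ false ∷ true ∷ true ∷ false ∷ true ∷ false ∷ [])
  ∷ (true ∷ true ∷ true ∷ true ∷ true ∷ false ∷ true ∷ false ∷ [])
  ∷ (false ∷ true ∷ false ∷ false ∷ false ∷ true ∷ true ∷ false ∷ [])
  ∷ (true ∷ true ∷ false ∷ false ∷ false ∷ true ∷ true ∷ false ∷ [])
  ∷ (true ∷ true ∷ true ∷ false ∷ false ∷ true ∷ true ∷ false ∷ [])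
  ∷ (true ∷ true ∷ false ∷ true ∷ false ∷ true ∷ true ∷ false ∷ [])
  ∷ (true ∷ true ∷ true ∷ true ∷ false ∷ true ∷ true ∷ false ∷ [])
  ∷ (true ∷ true ∷ false ∷ false ∷ true ∷ true ∷ true ∷ false ∷ [])
  ∷ (true ∷ true ∷ true ∷ false ∷ true ∷ true ∷ true ∷ false ∷ [])
  ∷ (true ∷ true ∷ false ∷ true ∷ true ∷ true ∷ true ∷ false ∷ [])
  ∷ (true ∷ true ∷ true ∷ true ∷ true ∷ true ∷ true ∷ false ∷ [])
  ∷ (true ∷ true ∷ false ∷ false ∷ false ∷ false ∷ false ∷ true ∷ [])
  ∷ (true ∷ true ∷ true ∷ false ∷ false ∷ false ∷ false ∷ true ∷ [])
  ∷ (true ∷ true ∷ false ∷ true ∷ false ∷ false ∷ false ∷ true ∷ [])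
  ∷ (true ∷ true ∷ true ∷ true ∷ false ∷ false ∷ false ∷ true ∷ [])
  ∷ (true ∷ true ∷ false ∷ false ∷ true ∷ false ∷ false ∷ true ∷ [])
  ∷ (true ∷ true ∷ true ∷ false ∷ true ∷ false ∷ false ∷ true ∷ [])
  ∷ (true ∷ true ∷ false ∷ true ∷ true ∷ false ∷ false ∷ true ∷ [])
  ∷ (true ∷ true ∷ true ∷ true ∷ true ∷ false ∷ false ∷ true ∷ [])
  ∷ (false ∷ true ∷ false ∷ false ∷ false ∷ true ∷ false ∷ true ∷ [])
  ∷ (true ∷ true ∷ false ∷ false ∷ false ∷ true ∷ false ∷ true ∷ [])
  ∷ (true ∷ true ∷ true ∷ false ∷ false ∷ true ∷ false ∷ true ∷ [])
  ∷ (true ∷ true ∷ false ∷ true ∷ false ∷ true ∷ false ∷ true ∷ [])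
  ∷ (true ∷ true ∷ true ∷ true ∷ false ∷ true ∷ false ∷ true ∷ [])
  ∷ (true ∷ true ∷ false ∷ false ∷ true ∷ true ∷ false ∷ true ∷ [])
  ∷ (true ∷ true ∷ true ∷ false ∷ true ∷ true ∷ false ∷ true ∷ [])
  ∷ (true ∷ true ∷ false ∷ true ∷ true ∷ true ∷ false ∷ true ∷ [])
  ∷ (true ∷ true ∷ true ∷ true ∷ true ∷ true ∷ false ∷ true ∷ [])
  ∷ (false ∷ true ∷ false ∷ false ∷ false ∷ false ∷ true ∷ true ∷ [])
  ∷ (true ∷ true ∷ false ∷ false ∷ false ∷ false ∷ true ∷ true ∷ [])
  ∷ (true ∷ true ∷ true ∷ false ∷ false ∷ false ∷ true ∷ true ∷ [])
  ∷ (true ∷ true ∷ false ∷ true ∷ false ∷ false ∷ true ∷ true ∷ [])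
  ∷ (true ∷ true ∷ true ∷ true ∷ false ∷ false ∷ true ∷ true ∷ [])
  ∷ (true ∷ true ∷ false ∷ false ∷ true ∷ false ∷ true ∷ true ∷ [])
  ∷ (true ∷ true ∷ true ∷ false ∷ true ∷ false ∷ true ∷ true ∷ [])
  ∷ (true ∷ true ∷ false ∷ true ∷ true ∷ false ∷ true ∷ true ∷ [])
  ∷ (true ∷ true ∷ true ∷ true ∷ true ∷ false ∷ true ∷ true ∷ [])
  ∷ (false ∷ true ∷ false ∷ false ∷ false ∷ true ∷ true ∷ true ∷ [])
  ∷ (true ∷ true ∷ false ∷ false ∷ false ∷ true ∷ true ∷ true ∷ [])
  ∷ (true ∷ true ∷ true ∷ false ∷ false ∷ true ∷ true ∷ true ∷ [])
  ∷ (true ∷ true ∷ false ∷ true ∷ false ∷ true ∷ true ∷ true ∷ [])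
  ∷ (true ∷ true ∷ true ∷ true ∷ false ∷ true ∷ true ∷ true ∷ [])
  ∷ (true ∷ true ∷ false ∷ false ∷ true ∷ true ∷ true ∷ true ∷ [])
  ∷ (true ∷ true ∷ true ∷ false ∷ true ∷ true ∷ true ∷ true ∷ [])
  ∷ (true ∷ true ∷ false ∷ true ∷ true ∷ true ∷ true ∷ true ∷ [])
  ∷ (true ∷ true ∷ true ∷ true ∷ true ∷ true ∷ true ∷ true ∷ [])
  ∷ []

F-3-4-9 : Family 9
F-3-4-9 =
  (true ∷ true ∷ false ∷ false ∷ true ∷ true ∷ false ∷ false ∷ false ∷ [])
  ∷ (true ∷ true ∷ false ∷ true ∷ false ∷ false ∷ false ∷ true ∷ false ∷ [])
  ∷ (true ∷ true ∷ false ∷ true ∷ true ∷ true ∷ false ∷ true ∷ false ∷ [])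
  ∷ (true ∷ true ∷ true ∷ false ∷ false ∷ false ∷ false ∷ false ∷ true ∷ [])
  ∷ (true ∷ true ∷ false ∷ true ∷ false ∷ false ∷ false ∷ false ∷ true ∷ [])
  ∷ (true ∷ true ∷ true ∷ true ∷ false ∷ false ∷ false ∷ false ∷ true ∷ [])
  ∷ (true ∷ true ∷ false ∷ false ∷ true ∷ false ∷ false ∷ false ∷ true ∷ [])
  ∷ (true ∷ true ∷ true ∷ false ∷ true ∷ false ∷ false ∷ false ∷ true ∷ [])
  ∷ (true ∷ true ∷ false ∷ true ∷ true ∷ false ∷ false ∷ false ∷ true ∷ [])
  ∷ (true ∷ true ∷ true ∷ true ∷ true ∷ false ∷ false ∷ false ∷ true ∷ [])
  ∷ (true ∷ true ∷ false ∷ false ∷ false ∷ true ∷ false ∷ false ∷ true ∷ [])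
  ∷ (true ∷ true ∷ true ∷ false ∷ false ∷ true ∷ false ∷ false ∷ true ∷ [])
  ∷ (true ∷ true ∷ false ∷ true ∷ false ∷ true ∷ false ∷ false ∷ true ∷ [])
  ∷ (true ∷ true ∷ true ∷ true ∷ false ∷ true ∷ false ∷ false ∷ true ∷ [])
  ∷ (true ∷ true ∷ false ∷ false ∷ true ∷ true ∷ false ∷ false ∷ true ∷ [])
  ∷ (true ∷ true ∷ true ∷ false ∷ true ∷ true ∷ false ∷ false ∷ true ∷ [])
  ∷ (true ∷ true ∷ false ∷ true ∷ true ∷ true ∷ false ∷ false ∷ true ∷ [])
  ∷ (true ∷ true ∷ true ∷ true ∷ true ∷ true ∷ false ∷ false ∷ true ∷ [])
  ∷ (true ∷ true ∷ false ∷ false ∷ false ∷ false ∷ true ∷ false ∷ true ∷ [])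
  ∷ (true ∷ false ∷ true ∷ false ∷ false ∷ false ∷ true ∷ false ∷ true ∷ [])
  ∷ (false ∷ true ∷ true ∷ false ∷ false ∷ false ∷ true ∷ false ∷ true ∷ [])
  ∷ (true ∷ true ∷ true ∷ false ∷ false ∷ false ∷ true ∷ false ∷ true ∷ [])
  ∷ (true ∷ true ∷ false ∷ true ∷ false ∷ false ∷ true ∷ false ∷ true ∷ [])
  ∷ (true ∷ true ∷ true ∷ true ∷ false ∷ false ∷ true ∷ false ∷ true ∷ [])
  ∷ (true ∷ true ∷ false ∷ false ∷ true ∷ false ∷ true ∷ false ∷ true ∷ [])
  ∷ (true ∷ true ∷ true ∷ false ∷ true ∷ false ∷ true ∷ false ∷ true ∷ [])
  ∷ (true ∷ true ∷ false ∷ true ∷ true ∷ false ∷ true ∷ false ∷ true ∷ [])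
  ∷ (true ∷ true ∷ true ∷ true ∷ true ∷ false ∷ true ∷ false ∷ true ∷ [])
  ∷ (true ∷ true ∷ false ∷ false ∷ false ∷ true ∷ true ∷ false ∷ true ∷ [])
  ∷ (true ∷ true ∷ true ∷ false ∷ false ∷ true ∷ true ∷ false ∷ true ∷ [])
  ∷ (true ∷ true ∷ false ∷ true ∷ false ∷ true ∷ true ∷ false ∷ true ∷ [])
  ∷ (true ∷ true ∷ true ∷ true ∷ false ∷ true ∷ true ∷ false ∷ true ∷ [])
  ∷ (true ∷ true ∷ false ∷ false ∷ true ∷ true ∷ true ∷ false ∷ true ∷ [])
  ∷ (true ∷ true ∷ true ∷ false ∷ true ∷ true ∷ true ∷ false ∷ true ∷ [])
  ∷ (true ∷ true ∷ false ∷ true ∷ true ∷ true ∷ true ∷ false ∷ true ∷ [])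
  ∷ (true ∷ true ∷ true ∷ true ∷ true ∷ true ∷ true ∷ false ∷ true ∷ [])
  ∷ (true ∷ true ∷ false ∷ false ∷ false ∷ false ∷ false ∷ true ∷ true ∷ [])
  ∷ (true ∷ true ∷ true ∷ false ∷ false ∷ false ∷ false ∷ true ∷ true ∷ [])
  ∷ (true ∷ true ∷ false ∷ true ∷ false ∷ false ∷ false ∷ true ∷ true ∷ [])
  ∷ (true ∷ true ∷ true ∷ true ∷ false ∷ false ∷ false ∷ true ∷ true ∷ [])
  ∷ (true ∷ true ∷ false ∷ false ∷ true ∷ false ∷ false ∷ true ∷ true ∷ [])
  ∷ (true ∷ true ∷ true ∷ false ∷ true ∷ false ∷ false ∷ true ∷ true ∷ [])
  ∷ (true ∷ true ∷ false ∷ true ∷ true ∷ false ∷ false ∷ true ∷ true ∷ [])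
  ∷ (true ∷ true ∷ true ∷ true ∷ true ∷ false ∷ false ∷ true ∷ true ∷ [])
  ∷ (true ∷ true ∷ false ∷ false ∷ false ∷ true ∷ false ∷ true ∷ true ∷ [])
  ∷ (true ∷ true ∷ true ∷ false ∷ false ∷ true ∷ false ∷ true ∷ true ∷ [])
  ∷ (true ∷ true ∷ false ∷ true ∷ false ∷ true ∷ false ∷ true ∷ true ∷ [])
  ∷ (true ∷ true ∷ true ∷ true ∷ false ∷ true ∷ false ∷ true ∷ true ∷ [])
  ∷ (true ∷ true ∷ false ∷ false ∷ true ∷ true ∷ false ∷ true ∷ true ∷ [])
  ∷ (true ∷ true ∷ true ∷ false ∷ true ∷ true ∷ false ∷ true ∷ true ∷ [])
  ∷ (true ∷ true ∷ false ∷ true ∷ true ∷ true ∷ false ∷ true ∷ true ∷ [])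
  ∷ (true ∷ true ∷ true ∷ true ∷ true ∷ true ∷ false ∷ true ∷ true ∷ [])
  ∷ (true ∷ true ∷ false ∷ false ∷ false ∷ false ∷ true ∷ true ∷ true ∷ [])
  ∷ (true ∷ true ∷ true ∷ false ∷ false ∷ false ∷ true ∷ true ∷ true ∷ [])
  ∷ (true ∷ true ∷ false ∷ true ∷ false ∷ false ∷ true ∷ true ∷ true ∷ [])
  ∷ (true ∷ true ∷ true ∷ true ∷ false ∷ false ∷ true ∷ true ∷ true ∷ [])
  ∷ (true ∷ true ∷ false ∷ false ∷ true ∷ false ∷ true ∷ true ∷ true ∷ [])
  ∷ (true ∷ true ∷ true ∷ false ∷ true ∷ false ∷ true ∷ true ∷ true ∷ [])
  ∷ (true ∷ true ∷ false ∷ true ∷ true ∷ false ∷ true ∷ true ∷ true ∷ [])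
  ∷ (true ∷ true ∷ true ∷ true ∷ true ∷ false ∷ true ∷ true ∷ true ∷ [])
  ∷ (true ∷ true ∷ false ∷ false ∷ false ∷ true ∷ true ∷ true ∷ true ∷ [])
  ∷ (true ∷ true ∷ true ∷ false ∷ false ∷ true ∷ true ∷ true ∷ true ∷ [])
  ∷ (true ∷ true ∷ false ∷ true ∷ false ∷ true ∷ true ∷ true ∷ true ∷ [])
  ∷ (true ∷ true ∷ true ∷ true ∷ false ∷ true ∷ true ∷ true ∷ true ∷ [])
  ∷ (true ∷ true ∷ false ∷ false ∷ true ∷ true ∷ true ∷ true ∷ true ∷ [])
  ∷ (true ∷ true ∷ true ∷ false ∷ true ∷ true ∷ true ∷ true ∷ true ∷ [])
  ∷ (true ∷ true ∷ false ∷ true ∷ true ∷ true ∷ true ∷ true ∷ true ∷ [])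
  ∷ (true ∷ true ∷ true ∷ true ∷ true ∷ true ∷ true ∷ true ∷ true ∷ [])
  ∷ []

F-4-5-9 : Family 9
F-4-5-9 =
  (true ∷ true ∷ false ∷ true ∷ true ∷ true ∷ false ∷ false ∷ false ∷ [])
  ∷ (true ∷ true ∷ false ∷ true ∷ true ∷ false ∷ true ∷ false ∷ false ∷ [])
  ∷ (true ∷ true ∷ false ∷ true ∷ false ∷ true ∷ true ∷ false ∷ false ∷ [])
  ∷ (true ∷ true ∷ false ∷ true ∷ true ∷ true ∷ true ∷ false ∷ false ∷ [])
  ∷ (true ∷ true ∷ true ∷ true ∷ false ∷ false ∷ false ∷ false ∷ true ∷ [])
  ∷ (true ∷ true ∷ false ∷ true ∷ true ∷ false ∷ false ∷ false ∷ true ∷ [])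
  ∷ (true ∷ true ∷ true ∷ true ∷ true ∷ false ∷ false ∷ false ∷ true ∷ [])
  ∷ (true ∷ true ∷ false ∷ true ∷ false ∷ true ∷ false ∷ false ∷ true ∷ [])
  ∷ (true ∷ true ∷ true ∷ true ∷ false ∷ true ∷ false ∷ false ∷ true ∷ [])
  ∷ (true ∷ true ∷ false ∷ true ∷ true ∷ true ∷ false ∷ false ∷ true ∷ [])
  ∷ (true ∷ true ∷ true ∷ true ∷ true ∷ true ∷ false ∷ false ∷ true ∷ [])
  ∷ (true ∷ true ∷ false ∷ true ∷ false ∷ false ∷ true ∷ false ∷ true ∷ [])
  ∷ (true ∷ true ∷ true ∷ true ∷ false ∷ false ∷ true ∷ false ∷ true ∷ [])
  ∷ (true ∷ true ∷ false ∷ true ∷ true ∷ false ∷ true ∷ false ∷ true ∷ [])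
  ∷ (true ∷ true ∷ true ∷ true ∷ true ∷ false ∷ true ∷ false ∷ true ∷ [])
  ∷ (true ∷ true ∷ false ∷ true ∷ false ∷ true ∷ true ∷ false ∷ true ∷ [])
  ∷ (true ∷ true ∷ true ∷ true ∷ false ∷ true ∷ true ∷ false ∷ true ∷ [])
  ∷ (true ∷ true ∷ false ∷ true ∷ true ∷ true ∷ true ∷ false ∷ true ∷ [])
  ∷ (true ∷ true ∷ true ∷ true ∷ true ∷ true ∷ true ∷ false ∷ true ∷ [])
  ∷ (true ∷ true ∷ true ∷ false ∷ false ∷ false ∷ false ∷ true ∷ true ∷ [])
  ∷ (true ∷ true ∷ false ∷ true ∷ false ∷ false ∷ false ∷ true ∷ true ∷ [])
  ∷ (true ∷ false ∷ true ∷ true ∷ false ∷ false ∷ false ∷ true ∷ true ∷ [])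
  ∷ (false ∷ true ∷ true ∷ true ∷ false ∷ false ∷ false ∷ true ∷ true ∷ [])
  ∷ (true ∷ true ∷ true ∷ true ∷ false ∷ false ∷ false ∷ true ∷ true ∷ [])
  ∷ (true ∷ true ∷ false ∷ true ∷ true ∷ false ∷ false ∷ true ∷ true ∷ [])
  ∷ (true ∷ true ∷ true ∷ true ∷ true ∷ false ∷ false ∷ true ∷ true ∷ [])
  ∷ (true ∷ true ∷ false ∷ true ∷ false ∷ true ∷ false ∷ true ∷ true ∷ [])
  ∷ (true ∷ true ∷ true ∷ true ∷ false ∷ true ∷ false ∷ true ∷ true ∷ [])
  ∷ (true ∷ true ∷ false ∷ true ∷ true ∷ true ∷ false ∷ true ∷ true ∷ [])
  ∷ (true ∷ true ∷ true ∷ true ∷ true ∷ true ∷ false ∷ true ∷ true ∷ [])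
  ∷ (true ∷ true ∷ false ∷ true ∷ false ∷ false ∷ true ∷ true ∷ true ∷ [])
  ∷ (true ∷ true ∷ true ∷ true ∷ false ∷ false ∷ true ∷ true ∷ true ∷ [])
  ∷ (true ∷ true ∷ false ∷ true ∷ true ∷ false ∷ true ∷ true ∷ true ∷ [])
  ∷ (true ∷ true ∷ true ∷ true ∷ true ∷ false ∷ true ∷ true ∷ true ∷ [])
  ∷ (true ∷ true ∷ false ∷ true ∷ false ∷ true ∷ true ∷ true ∷ true ∷ [])
  ∷ (true ∷ true ∷ true ∷ true ∷ false ∷ true ∷ true ∷ true ∷ true ∷ [])
  ∷ (true ∷ true ∷ false ∷ true ∷ true ∷ true ∷ true ∷ true ∷ true ∷ [])
  ∷ (true ∷ true ∷ true ∷ true ∷ true ∷ true ∷ true ∷ true ∷ true ∷ [])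
  ∷ []

F-5-6-10 : Family 10
F-5-6-10 =
  (true ∷ true ∷ false ∷ true ∷ true ∷ true ∷ true ∷ false ∷ false ∷ false ∷ [])
  ∷ (true ∷ true ∷ false ∷ true ∷ true ∷ true ∷ false ∷ true ∷ false ∷ false ∷ [])
  ∷ (true ∷ true ∷ false ∷ true ∷ true ∷ false ∷ true ∷ true ∷ false ∷ false ∷ [])
  ∷ (true ∷ true ∷ false ∷ true ∷ true ∷ true ∷ true ∷ true ∷ false ∷ false ∷ [])
  ∷ (true ∷ true ∷ true ∷ true ∷ true ∷ false ∷ false ∷ false ∷ false ∷ true ∷ [])
  ∷ (true ∷ true ∷ false ∷ true ∷ true ∷ true ∷ false ∷ false ∷ false ∷ true ∷ [])
  ∷ (true ∷ true ∷ true ∷ true ∷ true ∷ true ∷ false ∷ false ∷ false ∷ true ∷ [])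
  ∷ (true ∷ true ∷ false ∷ true ∷ true ∷ false ∷ true ∷ false ∷ false ∷ true ∷ [])
  ∷ (true ∷ true ∷ true ∷ true ∷ true ∷ false ∷ true ∷ false ∷ false ∷ true ∷ [])
  ∷ (true ∷ true ∷ false ∷ true ∷ true ∷ true ∷ true ∷ false ∷ false ∷ true ∷ [])
  ∷ (true ∷ true ∷ true ∷ true ∷ true ∷ true ∷ true ∷ false ∷ false ∷ true ∷ [])
  ∷ (true ∷ true ∷ false ∷ true ∷ true ∷ false ∷ false ∷ true ∷ false ∷ true ∷ [])
  ∷ (true ∷ true ∷ true ∷ true ∷ true ∷ false ∷ false ∷ true ∷ false ∷ true ∷ [])
  ∷ (true ∷ true ∷ false ∷ true ∷ true ∷ true ∷ false ∷ true ∷ false ∷ true ∷ [])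
  ∷ (true ∷ true ∷ true ∷ true ∷ true ∷ true ∷ false ∷ true ∷ false ∷ true ∷ [])
  ∷ (true ∷ true ∷ false ∷ true ∷ true ∷ false ∷ true ∷ true ∷ false ∷ true ∷ [])
  ∷ (true ∷ true ∷ true ∷ true ∷ true ∷ false ∷ true ∷ true ∷ false ∷ true ∷ [])
  ∷ (true ∷ true ∷ false ∷ true ∷ true ∷ true ∷ true ∷ true ∷ false ∷ true ∷ [])
  ∷ (true ∷ true ∷ true ∷ true ∷ true ∷ true ∷ true ∷ true ∷ false ∷ true ∷ [])
  ∷ (true ∷ true ∷ true ∷ true ∷ false ∷ false ∷ false ∷ false ∷ true ∷ true ∷ [])
  ∷ (true ∷ true ∷ false ∷ true ∷ true ∷ false ∷ false ∷ false ∷ true ∷ true ∷ [])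
  ∷ (true ∷ false ∷ true ∷ true ∷ true ∷ false ∷ false ∷ false ∷ true ∷ true ∷ [])
  ∷ (false ∷ true ∷ true ∷ true ∷ true ∷ false ∷ false ∷ false ∷ true ∷ true ∷ [])
  ∷ (true ∷ true ∷ true ∷ true ∷ true ∷ false ∷ false ∷ false ∷ true ∷ true ∷ [])
  ∷ (true ∷ true ∷ false ∷ true ∷ true ∷ true ∷ false ∷ false ∷ true ∷ true ∷ [])
  ∷ (true ∷ true ∷ true ∷ true ∷ true ∷ true ∷ false ∷ false ∷ true ∷ true ∷ [])
  ∷ (true ∷ true ∷ false ∷ true ∷ true ∷ false ∷ true ∷ false ∷ true ∷ true ∷ [])
  ∷ (true ∷ true ∷ true ∷ true ∷ true ∷ false ∷ true ∷ false ∷ true ∷ true ∷ [])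
  ∷ (true ∷ true ∷ false ∷ true ∷ true ∷ true ∷ true ∷ false ∷ true ∷ true ∷ [])
  ∷ (true ∷ true ∷ true ∷ true ∷ true ∷ true ∷ true ∷ false ∷ true ∷ true ∷ [])
  ∷ (true ∷ true ∷ false ∷ true ∷ true ∷ false ∷ false ∷ true ∷ true ∷ true ∷ [])
  ∷ (true ∷ true ∷ true ∷ true ∷ true ∷ false ∷ false ∷ true ∷ true ∷ true ∷ [])
  ∷ (true ∷ true ∷ false ∷ true ∷ true ∷ true ∷ false ∷ true ∷ true ∷ true ∷ [])
  ∷ (true ∷ true ∷ true ∷ true ∷ true ∷ true ∷ false ∷ true ∷ true ∷ true ∷ [])
  ∷ (true ∷ true ∷ false ∷ true ∷ true ∷ false ∷ true ∷ true ∷ true ∷ true ∷ [])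
  ∷ (true ∷ true ∷ true ∷ true ∷ true ∷ false ∷ true ∷ true ∷ true ∷ true ∷ [])
  ∷ (true ∷ true ∷ false ∷ true ∷ true ∷ true ∷ true ∷ true ∷ true ∷ true ∷ [])
  ∷ (true ∷ true ∷ true ∷ true ∷ true ∷ true ∷ true ∷ true ∷ true ∷ true ∷ [])
  ∷ []

F-2-0-3 : Family 3
F-2-0-3 =
  (false ∷ false ∷ false ∷ [])
  ∷ (true ∷ true ∷ false ∷ [])
  ∷ (true ∷ true ∷ true ∷ [])
  ∷ []

F-2-1-3 : Family 3
F-2-1-3 =
  (true ∷ false ∷ false ∷ [])
  ∷ (true ∷ true ∷ false ∷ [])
  ∷ (true ∷ true ∷ true ∷ [])
  ∷ []

F-2-2-3 : Family 3
F-2-2-3 =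
  (true ∷ true ∷ false ∷ [])
  ∷ (true ∷ true ∷ true ∷ [])
  ∷ []

twinFree-2-3-8 : TwinFreeConstruction 2 3 8
twinFree-2-3-8 = 8 , F-2-3-8 , checkConstruction-sound F-2-3-8 2 3 8 _ , separatedᵇ⇒twinFree F-2-3-8 _

twinFree-3-4-9 : TwinFreeConstruction 3 4 9
twinFree-3-4-9 = 9 , F-3-4-9 , checkConstruction-sound F-3-4-9 3 4 9 _ , separatedᵇ⇒twinFree F-3-4-9 _

twinFree-4-5-9 : TwinFreeConstruction 4 5 9
twinFree-4-5-9 = 9 , F-4-5-9 , checkConstruction-sound F-4-5-9 4 5 9 _ , separatedᵇ⇒twinFree F-4-5-9 _

twinFree-5-6-10 : TwinFreeConstruction 5 6 10
twinFree-5-6-10 = 10 , F-5-6-10 , checkConstruction-sound F-5-6-10 5 6 10 _ , separatedᵇ⇒twinFree F-5-6-10 _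

construction-2-0-3 : Construction 2 0 3
construction-2-0-3 = 3 , F-2-0-3 , checkConstruction-sound F-2-0-3 2 0 3 _

construction-2-1-3 : Construction 2 1 3
construction-2-1-3 = 3 , F-2-1-3 , checkConstruction-sound F-2-1-3 2 1 3 _

construction-2-2-3 : Construction 2 2 3
construction-2-2-3 = 3 , F-2-2-3 , checkConstruction-sound F-2-2-3 2 2 3 _

Construction-2 : ∀ k n → 3 ⊔ (5 * k ∸ 4) ≤ n → Construction 2 k n
Construction-2 0 n 3≤n = Construction-mono 3≤n construction-2-0-3
Construction-2 1 n 3≤n = Construction-mono 3≤n construction-2-1-3
Construction-2 2 n 6≤n = Construction-mono (≤-trans (m≤m+n 3 3) 6≤n) construction-2-2-3
Construction-2 3 n 11≤n = Construction-mono (≤-trans (m≤m+n 8 3) 11≤n) (TwinFreeConstruction⇒Construction twinFree-2-3-8)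
Construction-2 (suc (suc (suc (suc j)))) n bound with halves j
... | even v = Construction-mono (≤-trans (m≤m+n _ 4) (≤-trans (≤-reflexive (sym size≡)) (≤-trans (m≤n⊔m 3 _) bound)))
                                 (construction-even v)
  where
  open +-*-Solver
  size≡ : 5 * (4 + (v + v)) ∸ 4 ≡ 2 + 10 * suc v + 4
  size≡ = ∸-cancel _ 4 (solve 1 (λ v → con 5 :* (con 4 :+ (v :+ v)) := con 2 :+ con 10 :* (con 1 :+ v) :+ con 4 :+ con 4) refl v)
... | odd v = Construction-mono (≤-trans (≤-reflexive (sym size≡)) (≤-trans (m≤n⊔m 3 _) bound)) (construction-odd v)
  where
  open +-*-Solver
  size≡ : 5 * (5 + (v + v)) ∸ 4 ≡ 3 + (v + 9 * (2 + v))
  size≡ = ∸-cancel _ 4 (solve 1 (λ v → con 5 :* (con 5 :+ (v :+ v)) := con 3 :+ (v :+ con 9 :* (con 2 :+ v)) :+ con 4) refl v)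

Construction-2-even : ∀ k n → 2 ∣ k → 3 ⊔ (5 * k ∸ 8) ≤ n → Construction 2 k n
Construction-2-even 0 n _ 3≤n = Construction-mono 3≤n construction-2-0-3
Construction-2-even 1 n 2∣1 _ = contradiction 2∣1 (2∤odd 0)
Construction-2-even 2 n _ 3≤n = Construction-mono 3≤n construction-2-2-3
Construction-2-even 3 n 2∣3 _ = contradiction 2∣3 (2∤odd 1)
Construction-2-even (suc (suc (suc (suc j)))) n 2∣k bound with halves j
... | even v = Construction-mono (≤-trans (≤-reflexive (sym size≡)) (≤-trans (m≤n⊔m 3 _) bound)) (construction-even v)
  where
  open +-*-Solver
  size≡ : 5 * (4 + (v + v)) ∸ 8 ≡ 2 + 10 * suc v
  size≡ = ∸-cancel _ 8 (solve 1 (λ v → con 5 :* (con 4 :+ (v :+ v)) := con 2 :+ con 10 :* (con 1 :+ v) :+ con 8) refl v)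
... | odd v = contradiction (subst (2 ∣_) (cong suc (solve 1 (λ v → con 4 :+ (v :+ v) := (con 2 :+ v) :+ (con 2 :+ v)) refl v)) 2∣k) (2∤odd (2 + v))
  where open +-*-Solver

Construction-k∸1 : ∀ k n → 3 ≤ k → k + 4 ≤ n → 9 ≤ n → Construction (k ∸ 1) k n
Construction-k∸1 0 n () _ _
Construction-k∸1 1 n (s≤s ()) _ _
Construction-k∸1 2 n (s≤s (s≤s ())) _ _
Construction-k∸1 3 n _ _ 9≤n = Construction-mono 9≤n (Construction-suc (TwinFreeConstruction⇒Construction twinFree-2-3-8))
Construction-k∸1 4 n _ _ 9≤n = Construction-mono 9≤n (TwinFreeConstruction⇒Construction twinFree-3-4-9)
Construction-k∸1 (suc (suc (suc (suc (suc j))))) n _ k+4≤n _ =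
  Construction-mono (subst (_≤ n) (+-comm (5 + j) 4 ⟨ trans ⟩ +-comm 9 j) k+4≤n)
    (subst₂ (λ f k → Construction f k (j + 9)) (+-comm j 4) (+-comm j 5) (Construction-withUniversal^ j (TwinFreeConstruction⇒Construction twinFree-4-5-9)))

theorem2 :
    (TwinFreeConstruction 2 3 8 × TwinFreeConstruction 3 4 9
      × TwinFreeConstruction 4 5 9 × TwinFreeConstruction 5 6 10)
    × ((∀ k n → 3 ≤ k → Ineq k n → TwinFreeConstruction 2 k n)
      × (∀ k → 3 ≤ k → ∃[ N ] (∀ n → N ≤ n → Ineq k n)))
    × ((∀ k n → 3 ⊔ (5 * k ∸ 4) ≤ n → Construction 2 k n)
      × (∀ k n → 2 ∣ k → 3 ⊔ (5 * k ∸ 8) ≤ n → Construction 2 k n))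
    × (∀ k n → 3 ≤ k → k + 4 ≤ n → 9 ≤ n → Construction (k ∸ 1) k n)
theorem2 =
  (twinFree-2-3-8 , twinFree-3-4-9 , twinFree-4-5-9 , twinFree-5-6-10) ,
  (Ineq⇒TwinFreeConstruction , Ineq-eventually) ,
  (Construction-2 , Construction-2-even) ,
  Construction-k∸1
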